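{- Let $\tau$ be a simplicial facet of a Newton polyhedron $\Gamma\subset\mathbb{R}^n$ and let $\sigma,\sigma'$ be V-faces contained in $\tau$ with $\sigma\cap\sigma'\neq\emptyset$, and let $M\in\mathbb{N}$ be such that $\mathrm{NV}(\tau)\,\mathrm{NV}(\sigma\cap\sigma')=\mathrm{NV}(\sigma)\,\mathrm{NV}(\sigma')\,M$. If $\sigma$ and $\sigma'$ contribute with respect to $\tau$ and $\sigma\cap\sigma'$ does not, then $M\ge2$.
   Context: A Newton polyhedron in $\mathbb{R}^n$ is the convex hull of $\bigcup_{\underline{k}\in S}(\underline{k}+\mathbb{R}^n_{\ge0})$ for a non-empty finite set $S\subset\mathbb{Z}^n_{\ge0}$. A simplicial facet is a compact face of dimension $n-1$ which is a simplex; for a facet $\tau$ with primitive normal vector $\underline{a}\in\mathbb{Z}^n_{\ge0}$ and supporting hyperplane $\underline{a}\cdot x=N(\tau)$, put $\nu(\tau)=a_1+\dots+a_n$. For $I\subset\{1,\dots,n\}$ let $L_I=\{x: x_i=0\ \forall i\notin I\}$. A compact face $\sigma$ is a V-face if $\sigma\subset L_I$ for some $I=I_\sigma$ with $\#I=\dim\sigma+1$; write the equation of $\mathrm{Aff}(\sigma)$ in $L_{I_\sigma}$ as $\sum_{i\in I_\sigma}a_ix_i=N(\sigma)$ with positive integers, $\gcd(a_i)=1$ (for a point $le_i$ this is $N=l$). $\mathrm{NV}(\sigma)$ is $(\dim\sigma)!$ times the volume of $\sigma$ for the volume form on $\mathrm{Aff}(\sigma)$ normalized by the lattice $\mathbb{Z}^n\cap\mathrm{Aff}(\sigma)$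 ($\mathrm{NV}=1$ for points). Put $\zeta_\sigma(t)=(1-t^{N(\sigma)})^{\mathrm{NV}(\sigma)}$. A V-face $\sigma$ contributes with respect to the facet $\tau$ if $e^{ -2\pi i\nu(\tau)/N(\tau)}$ is a zero of $\zeta_\sigma(t)$. (Such an $M\in\mathbb{N}$ always exists.) -}

module Defs where

open import Data.Nat using (ℕ; zero; suc; _+_; _*_; _≤_)
open import Data.Nat.Divisibility using (_∣_)
open import Data.Integer as ℤ using (ℤ; +_)
open import Data.Rational as ℚ using (ℚ; 0ℚ; 1ℚ)
open import Data.Fin using (Fin; zero; suc)
open import Data.Fin.Subset using (Subset; _∈_; _∉_; ∣_∣)
open import Data.Vec using (Vec; lookup)
open import Data.List as L using (List)
open import Data.List.Membership.Propositional as LM using ()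
open import Data.List.Relation.Unary.Unique.Propositional using (Unique)
open import Data.Product using (Σ; _×_)
open import Data.Sum using (_⊎_)
open import Relation.Binary.PropositionalEquality using (_≡_)

sumℕ : ∀ {n} → (Fin n → ℕ) → ℕ
sumℕ {zero} f = 0
sumℕ {suc n} f = f zero + sumℕ (λ i → f (suc i))

sumℚ : ∀ {n} → (Fin n → ℚ) → ℚ
sumℚ {zero} f = 0ℚ
sumℚ {suc n} f = f zero ℚ.+ sumℚ (λ i → f (suc i))

Point : ℕ → Set
Point n = Vec ℕ n

ℕtoℚ : ℕ → ℚ
ℕtoℚ k = (+ k) ℚ./ 1

ℤtoℚ : ℤ → ℚ
ℤtoℚ z = z ℚ./ 1

dot : ∀ {n} → (Fin n → ℕ) → Point n → ℕ
dot a x = sumℕ (λ i → a i * lookup x i)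

ν : ∀ {n} → (Fin n → ℕ) → ℕ
ν a = sumℕ a

Primitive : ∀ {n} → (Fin n → ℕ) → Set
Primitive a = ∀ d → (∀ i → d ∣ a i) → d ≡ 1

PrimitiveOn : ∀ {n} → Subset n → (Fin n → ℕ) → Set
PrimitiveOn I b = ∀ d → (∀ i → i ∈ I → d ∣ b i) → d ≡ 1

-- the points v_1,…,v_m are affinely independent (over ℚ, equivalently over ℝ)
AffIndep : ∀ {m n} → (Fin m → Point n) → Set
AffIndep {m} {n} v =
  (λs : Fin m → ℚ) → sumℚ λs ≡ 0ℚ →
  (∀ i → sumℚ (λ j → λs j ℚ.* ℕtoℚ (lookup (v j) i)) ≡ 0ℚ) →
  ∀ j → λs j ≡ 0ℚ

-- k lies in the convex hull of the v_j (rational coefficients suffice for rational points)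
InConv : ∀ {m n} → (Fin m → Point n) → Point n → Set
InConv {m} {n} v k =
  Σ (Fin m → ℚ) λ λs →
    (∀ j → 0ℚ ℚ.≤ λs j) × (sumℚ λs ≡ 1ℚ) ×
    (∀ i → ℕtoℚ (lookup k i) ≡ sumℚ (λ j → λs j ℚ.* ℕtoℚ (lookup (v j) i)))

-- Γ = Newton polyhedron of S.  τ = conv(v_1,…,v_n) is a simplicial facet of Γ
-- with primitive normal a (positive entries, since τ is compact) and
-- supporting hyperplane a·x = N, i.e. τ = Γ ∩ {a·x = N}, N = min_Γ a·x.
IsSimplicialFacet : ∀ {n} → List (Point n) → (Fin n → ℕ) → (Fin n → Point n) → ℕ → Set
IsSimplicialFacet {n} S a v N =
  (∀ i → 1 ≤ a i) × Primitive a ×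
  (∀ k → k LM.∈ S → N ≤ dot a k) ×
  (∀ j → v j LM.∈ S) × (∀ j → dot a (v j) ≡ N) ×
  AffIndep v ×
  (∀ k → k LM.∈ S → dot a k ≡ N → InConv v k)

-- The face σ = conv{v_j : j ∈ J} of τ is a V-face, witnessed by I = I_σ.
IsVFace : ∀ {n} → (Fin n → Point n) → Subset n → Subset n → Set
IsVFace v J I = (∣ I ∣ ≡ ∣ J ∣) × (∀ j → j ∈ J → ∀ i → i ∉ I → lookup (v j) i ≡ 0)

-- σ = conv{v_j : j ∈ J} is a V-face and N(σ) = N: Aff(σ) in L_I is Σ_{i∈I} b_i x_i = N,
-- b_i positive integers with gcd 1.
IsN : ∀ {n} → (Fin n → Point n) → Subset n → ℕ → Set
IsN {n} v J N =
  Σ (Subset n) λ I → IsVFace v J I ×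
  Σ (Fin n → ℕ) λ b →
    (∀ i → i ∈ I → 1 ≤ b i) × (∀ i → i ∉ I → b i ≡ 0) × PrimitiveOn I b ×
    (∀ j → j ∈ J → dot b (v j) ≡ N)

ParPoint : ∀ {n} → (Fin n → Point n) → Subset n → Fin n → Vec ℤ n → Set
ParPoint {n} v J j0 p =
  Σ (Fin n → ℚ) λ λs →
    (∀ j → (j ∉ J ⊎ j ≡ j0) → λs j ≡ 0ℚ) ×
    (∀ j → (0ℚ ℚ.≤ λs j) × (λs j ℚ.< 1ℚ)) ×
    (∀ i → ℤtoℚ (lookup p i) ≡
           sumℚ (λ j → λs j ℚ.* (ℕtoℚ (lookup (v j) i) ℚ.- ℕtoℚ (lookup (v j0) i))))

-- NV(conv{v_j : j ∈ J}) = m : the normalized lattice volume of the lattice simplex,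
-- i.e. the index of the lattice spanned by its edge vectors in Z^n ∩ (its direction space),
-- i.e. the number of lattice points in the half-open fundamental parallelepiped.
IsNV : ∀ {n} → (Fin n → Point n) → Subset n → ℕ → Set
IsNV {n} v J m =
  Σ (Fin n) λ j0 → j0 ∈ J ×
  Σ (List (Vec ℤ n)) λ ps →
    (L.length ps ≡ m) × Unique ps ×
    (∀ p → (p LM.∈ ps → ParPoint v J j0 p) × (ParPoint v J j0 p → p LM.∈ ps))

-- a V-face with N(σ) = N and NV(σ) = m contributes w.r.t. τ (N(τ) = Nτ, ν(τ) = ντ):
-- e^{-2πi ντ/Nτ} is a zero of (1 - t^N)^m, i.e. m ≥ 1 and (e^{-2πi ντ/Nτ})^N = 1.
Contributes : ℕ → ℕ → ℕ → ℕ → Set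
Contributes Nτ ντ N m = (1 ≤ m) × (Nτ ∣ ντ * N)

{-# OPTIONS --safe #-}
module Submission where

open import Defs
open import Data.Nat using (ℕ; _*_; _≤_)
open import Data.Fin using (Fin)
open import Data.Fin.Subset using (Subset; ⊤; _∩_; Nonempty)
open import Data.List using (List)
open import Relation.Binary.PropositionalEquality using (_≡_)
open import Relation.Nullary using (¬_)

open import Algebra.Bundles using (CommutativeRing)
open import Data.Empty using (⊥-elim)
open import Data.Fin as Fin using (zero; suc)
import Data.Fin.Properties as Fin
open import Data.Fin.Subset using (_∈_; _∉_; ∣_∣; _-_; inside; outside)
open import Data.Fin.Subset.Properties
  using ( _∈?_; ∈⊤; nonempty?; Empty-unique; ∣⊥∣≡0; p─⊥≡p; p─q⊆p; x∈p∧x≢y⇒x∈p-y; x∈p⇒∣p-x∣<∣p∣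
        ; x∈p∩q⁺)
open import Data.Integer as ℤ using (ℤ; +_; -[1+_])
import Data.Integer.DivMod as ℤ
import Data.Integer.GCD as ℤ
import Data.Integer.Properties as ℤ
open import Data.Integer.Solver using () renaming (module +-*-Solver to ℤ-Solver)
open import Data.List using ([]; _∷_)
import Data.List as List
import Data.List.Properties as List
open import Data.List.Membership.Propositional using () renaming (_∈_ to _∈L_)
open import Data.List.Membership.Propositional.Properties using (∈-filter⁺; ∈-cartesianProduct⁺; ∈-cartesianProduct⁻)
import Data.List.Relation.Unary.All as All
open import Data.List.Relation.Unary.AllPairs using ([]; _∷_)
open import Data.List.Relation.Unary.Any using (here; there)
import Data.List.Relation.Unary.Any as Any
open import Data.List.Relation.Unary.Unique.Propositional using (Unique)
import Data.List.Relation.Unary.Unique.Propositional.Properties as Unique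
open import Data.Maybe using (just; fromMaybe)
open import Data.Nat as ℕ using (zero; suc; _+_; _<_; z≤n; s≤s)
open import Data.Nat.Divisibility using (_∣_; divides; ∣-trans; *-cancelʳ-∣; *-monoˡ-∣)
import Data.Nat.GCD as ℕ
open import Data.Nat.GCD using (module Bézout)
import Data.Nat.Properties as ℕ
open import Data.Nat.Solver using () renaming (module +-*-Solver to ℕ-Solver)
open import Data.Product using (∃-syntax; _×_; _,_; proj₁; proj₂)
import Data.Product.Properties as Product
open import Data.Rational as ℚ using (ℚ; mkℚ; 0ℚ; 1ℚ)
import Data.Rational.Properties as ℚ
open import Data.Rational.Solver using (module +-*-Solver)
import Data.Rational.Unnormalised as ℚᵘ
import Data.Rational.Unnormalised.Properties as ℚᵘ
open import Data.Sum using (_⊎_; inj₁; inj₂; [_,_]′)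
open import Data.Vec as Vec using (Vec; []; _∷_; here; there; lookup; tabulate)
import Data.Vec.Functional as Vector
import Data.Vec.Properties as Vec
open import Function using (_∘_)
open import Relation.Binary.Definitions using (DecidableEquality)
open import Relation.Binary.PropositionalEquality
  using (_≢_; refl; sym; trans; cong; cong₂; subst; subst₂; module ≡-Reasoning)
open import Relation.Nullary using (yes; no; ¬?)
open import Relation.Nullary.Decidable using (_×-dec_; decidable-stable; toSum)
import Relation.Unary as U

open import Algebra.Properties.Group ℚ.+-0-group
  using () renaming (x∙y⁻¹≈ε⇒x≈y to p-q≡0⇒p≡q; inverseʳ-unique to p+q≡0⇒q≡-p)
open import Algebra.Properties.Semiring.Sum (CommutativeRing.semiring ℚ.+-*-commutativeRing)
  using (sum; sum-cong-≗; ∑-distrib-+; ∑-comm; *-distribˡ-sum; *-distribʳ-sum; sum-replicate-zero; sum-remove)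
open import Algebra.Properties.Semiring.Sum ℤ.+-*-semiring
  using () renaming (sum to sumℤ; sum-cong-≗ to sumℤ-cong; *-distribˡ-sum to *-distribˡ-sumℤ)

-- For a face ρ of τ let P(ρ) be the lattice points of the half-open fundamental parallelepiped
-- of ρ, so #P(ρ) = NV(ρ), and put κ = σ ∩ σ′. If N(τ) = s · N(ρ) then a = s · b on I(ρ), where
-- Σ bᵢ xᵢ = N(ρ) is the equation of Aff(ρ) in L(I(ρ)); hence ρ contributes iff s ∣ ν(τ).
-- Reducing p + q modulo the edge lattice of τ maps P(σ) × P(σ′) to P(τ). Within a fibre the first
-- components are congruent modulo the edge lattice of κ, so pairing the image with the reduction
-- of p − p₀, for p₀ from a fixed pair of the fibre, is an injection P(σ) × P(σ′) → P(τ) × P(κ).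
-- As σ and σ′ contribute, L(I(σ)) and L(I(σ′)) contain lattice points y, y′ with
-- a · y = a · y′ = ν(τ), and no pair is sent to the class of y − y′, for otherwise κ would
-- contribute. Hence NV(σ) NV(σ′) < NV(τ) NV(κ) = NV(σ) NV(σ′) M.

-- Integers inside ℚ

↥-ℤtoℚ : ∀ z → ℚ.↥ ℤtoℚ z ≡ z
↥-ℤtoℚ z = trans (sym (ℤ.*-identityʳ _))
  (trans (cong (ℚ.↥ ℤtoℚ z ℤ.*_) (sym (ℤ.gcd-zeroʳ z))) (ℚ.↥-/ z 1))

↧-ℤtoℚ : ∀ z → ℚ.↧ ℤtoℚ z ≡ + 1
↧-ℤtoℚ z = trans (sym (ℤ.*-identityʳ _))
  (trans (cong (ℚ.↧ ℤtoℚ z ℤ.*_) (sym (ℤ.gcd-zeroʳ z))) (ℚ.↧-/ z 1))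

toℚᵘ-ℤtoℚ : ∀ z → ℚ.toℚᵘ (ℤtoℚ z) ℚᵘ.≃ ℚᵘ.mkℚᵘ z 0
toℚᵘ-ℤtoℚ z = ℚ.toℚᵘ-fromℚᵘ (ℚᵘ.mkℚᵘ z 0)

module _ where
  open ℚᵘ.≃-Reasoning

  ℤtoℚ-+ : ∀ x y → ℤtoℚ (x ℤ.+ y) ≡ ℤtoℚ x ℚ.+ ℤtoℚ y
  ℤtoℚ-+ x y = ℚ.toℚᵘ-injective (begin
    ℚ.toℚᵘ (ℤtoℚ (x ℤ.+ y))
      ≈⟨ toℚᵘ-ℤtoℚ (x ℤ.+ y) ⟩
    ℚᵘ.mkℚᵘ (x ℤ.+ y) 0
      ≈⟨ ℚᵘ.*≡* (cong (ℤ._* + 1) (cong₂ ℤ._+_ (sym (ℤ.*-identityʳ x)) (sym (ℤ.*-identityʳ y)))) ⟩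
    ℚᵘ.mkℚᵘ x 0 ℚᵘ.+ ℚᵘ.mkℚᵘ y 0
      ≈⟨ ℚᵘ.+-cong (ℚᵘ.≃-sym (toℚᵘ-ℤtoℚ x)) (ℚᵘ.≃-sym (toℚᵘ-ℤtoℚ y)) ⟩
    ℚ.toℚᵘ (ℤtoℚ x) ℚᵘ.+ ℚ.toℚᵘ (ℤtoℚ y)
      ≈⟨ ℚᵘ.≃-sym (ℚ.toℚᵘ-homo-+ (ℤtoℚ x) (ℤtoℚ y)) ⟩
    ℚ.toℚᵘ (ℤtoℚ x ℚ.+ ℤtoℚ y) ∎)

  ℤtoℚ-* : ∀ x y → ℤtoℚ (x ℤ.* y) ≡ ℤtoℚ x ℚ.* ℤtoℚ y
  ℤtoℚ-* x y = ℚ.toℚᵘ-injective (begin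
    ℚ.toℚᵘ (ℤtoℚ (x ℤ.* y))
      ≈⟨ toℚᵘ-ℤtoℚ (x ℤ.* y) ⟩
    ℚᵘ.mkℚᵘ (x ℤ.* y) 0
      ≈⟨ ℚᵘ.*≡* refl ⟩
    ℚᵘ.mkℚᵘ x 0 ℚᵘ.* ℚᵘ.mkℚᵘ y 0
      ≈⟨ ℚᵘ.*-cong (ℚᵘ.≃-sym (toℚᵘ-ℤtoℚ x)) (ℚᵘ.≃-sym (toℚᵘ-ℤtoℚ y)) ⟩
    ℚ.toℚᵘ (ℤtoℚ x) ℚᵘ.* ℚ.toℚᵘ (ℤtoℚ y)
      ≈⟨ ℚᵘ.≃-sym (ℚ.toℚᵘ-homo-* (ℤtoℚ x) (ℤtoℚ y)) ⟩
    ℚ.toℚᵘ (ℤtoℚ x ℚ.* ℤtoℚ y) ∎)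

  ℤtoℚ-neg : ∀ x → ℤtoℚ (ℤ.- x) ≡ ℚ.- ℤtoℚ x
  ℤtoℚ-neg x = ℚ.toℚᵘ-injective (begin
    ℚ.toℚᵘ (ℤtoℚ (ℤ.- x))      ≈⟨ toℚᵘ-ℤtoℚ (ℤ.- x) ⟩
    ℚᵘ.mkℚᵘ (ℤ.- x) 0           ≈⟨ ℚᵘ.*≡* refl ⟩
    ℚᵘ.- ℚᵘ.mkℚᵘ x 0            ≈⟨ ℚᵘ.-‿cong (ℚᵘ.≃-sym (toℚᵘ-ℤtoℚ x)) ⟩
    ℚᵘ.- ℚ.toℚᵘ (ℤtoℚ x)        ≈⟨ ℚᵘ.≃-sym (ℚ.toℚᵘ-homo‿- (ℤtoℚ x)) ⟩
    ℚ.toℚᵘ (ℚ.- ℤtoℚ x)        ∎)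

ℤtoℚ-- : ∀ x y → ℤtoℚ (x ℤ.- y) ≡ ℤtoℚ x ℚ.- ℤtoℚ y
ℤtoℚ-- x y = trans (ℤtoℚ-+ x (ℤ.- y)) (cong (ℤtoℚ x ℚ.+_) (ℤtoℚ-neg y))

ℤtoℚ-injective : ∀ {x y} → ℤtoℚ x ≡ ℤtoℚ y → x ≡ y
ℤtoℚ-injective {x} {y} eq = trans (sym (↥-ℤtoℚ x)) (trans (cong ℚ.↥_ eq) (↥-ℤtoℚ y))

ℤtoℚ-cancel-< : ∀ {x y} → ℤtoℚ x ℚ.< ℤtoℚ y → x ℤ.< y
ℤtoℚ-cancel-< {x} {y} x<y = subst₂ ℤ._<_ (cross x y) (cross y x) (ℚ.drop-*<* x<y)
  where
  cross : ∀ p q → ℚ.↥ ℤtoℚ p ℤ.* ℚ.↧ ℤtoℚ q ≡ p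
  cross p q = trans (cong₂ ℤ._*_ (↥-ℤtoℚ p) (↧-ℤtoℚ q)) (ℤ.*-identityʳ p)

ℕtoℚ-+ : ∀ m k → ℕtoℚ (m + k) ≡ ℕtoℚ m ℚ.+ ℕtoℚ k
ℕtoℚ-+ m k = ℤtoℚ-+ (+ m) (+ k)

ℕtoℚ-* : ∀ m k → ℕtoℚ (m * k) ≡ ℕtoℚ m ℚ.* ℕtoℚ k
ℕtoℚ-* m k = trans (cong ℤtoℚ (ℤ.pos-* m k)) (ℤtoℚ-* (+ m) (+ k))

ℕtoℚ-injective : ∀ {m k} → ℕtoℚ m ≡ ℕtoℚ k → m ≡ k
ℕtoℚ-injective eq = ℤ.+-injective (ℤtoℚ-injective eq)

Integral : ℚ → Set
Integral q = ∃[ z ] q ≡ ℤtoℚ z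

integral-ℤtoℚ : ∀ z → Integral (ℤtoℚ z)
integral-ℤtoℚ z = z , refl

integral-+ : ∀ {p q} → Integral p → Integral q → Integral (p ℚ.+ q)
integral-+ (x , refl) (y , refl) = x ℤ.+ y , sym (ℤtoℚ-+ x y)

integral-neg : ∀ {p} → Integral p → Integral (ℚ.- p)
integral-neg (x , refl) = ℤ.- x , sym (ℤtoℚ-neg x)

integral-- : ∀ {p q} → Integral p → Integral q → Integral (p ℚ.- q)
integral-- p q = integral-+ p (integral-neg q)

integral-* : ∀ {p q} → Integral p → Integral q → Integral (p ℚ.* q)
integral-* (x , refl) (y , refl) = x ℤ.* y , sym (ℤtoℚ-* x y)

floor-≤ : ∀ q → ℤtoℚ (ℚ.floor q) ℚ.≤ q
floor-≤ q@(mkℚ n d _) = ℚ.*≤* (subst₂ ℤ._≤_ (sym floor×den) (sym num) (ℤ.[n/ℕd]*d≤n n (suc d)))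
  where
  floor×den : ℚ.↥ ℤtoℚ (ℚ.floor q) ℤ.* ℚ.↧ q ≡ (n ℤ./ℕ suc d) ℤ.* + suc d
  floor×den = cong (ℤ._* + suc d) (trans (↥-ℤtoℚ (ℚ.floor q)) (ℤ.div-pos-is-/ℕ n (suc d)))
  num : ℚ.↥ q ℤ.* ℚ.↧ ℤtoℚ (ℚ.floor q) ≡ n
  num = trans (cong (n ℤ.*_) (↧-ℤtoℚ (ℚ.floor q))) (ℤ.*-identityʳ n)

<-floor+1 : ∀ q → q ℚ.< ℤtoℚ (ℚ.floor q) ℚ.+ 1ℚ
<-floor+1 q@(mkℚ n d _) = subst (q ℚ.<_) (ℤtoℚ-+ (ℚ.floor q) (+ 1))
  (ℚ.*<* (subst₂ ℤ._<_ (sym num) (sym floor+1×den) (ℤ.n<s[n/ℕd]*d n (suc d))))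
  where
  floor+1×den : ℚ.↥ ℤtoℚ (ℚ.floor q ℤ.+ + 1) ℤ.* ℚ.↧ q ≡ ℤ.suc (n ℤ./ℕ suc d) ℤ.* + suc d
  floor+1×den = cong (ℤ._* + suc d) (trans (↥-ℤtoℚ (ℚ.floor q ℤ.+ + 1))
    (trans (ℤ.+-comm (ℚ.floor q) (+ 1)) (cong (ℤ._+_ (+ 1)) (ℤ.div-pos-is-/ℕ n (suc d)))))
  num : ℚ.↥ q ℤ.* ℚ.↧ ℤtoℚ (ℚ.floor q ℤ.+ + 1) ≡ n
  num = trans (cong (n ℤ.*_) (↧-ℤtoℚ (ℚ.floor q ℤ.+ + 1))) (ℤ.*-identityʳ n)

-- Unlike ℚ.fracPart p = ∣ p − truncate p ∣, frac lies in [0,1) also for negative arguments.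
frac : ℚ → ℚ
frac q = q ℚ.- ℤtoℚ (ℚ.floor q)

integral-q-frac : ∀ q → Integral (q ℚ.- frac q)
integral-q-frac q = ℚ.floor q , solve 2 (λ q f → q :- (q :- f) := f) refl q (ℤtoℚ (ℚ.floor q))
  where open +-*-Solver

HalfOpenUnit : ℚ → Set
HalfOpenUnit x = 0ℚ ℚ.≤ x × x ℚ.< 1ℚ

halfOpenUnit-integral-diff⇒≡ : ∀ {x y} → HalfOpenUnit x → HalfOpenUnit y → Integral (x ℚ.- y) → x ≡ y
halfOpenUnit-integral-diff⇒≡ {x} {y} (0≤x , x<1) (0≤y , y<1) (z , x-y≡z) =
  p-q≡0⇒p≡q x y (trans x-y≡z (cong ℤtoℚ (z≡0 z (ℤtoℚ-cancel-< z<1) (ℤtoℚ-cancel-< -z<1))))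
  where
  diff<1 : ∀ {a b} → a ℚ.< 1ℚ → 0ℚ ℚ.≤ b → a ℚ.- b ℚ.< 1ℚ
  diff<1 a<1 0≤b = ℚ.+-mono-<-≤ a<1 (ℚ.neg-antimono-≤ 0≤b)
  z<1 : ℤtoℚ z ℚ.< ℤtoℚ (+ 1)
  z<1 = subst (ℚ._< 1ℚ) x-y≡z (diff<1 x<1 0≤y)
  -z<1 : ℤtoℚ (ℤ.- z) ℚ.< ℤtoℚ (+ 1)
  -z<1 = subst (ℚ._< 1ℚ) y-x≡-z (diff<1 y<1 0≤x)
    where
    y-x≡-z : y ℚ.- x ≡ ℤtoℚ (ℤ.- z)
    y-x≡-z = trans (solve 2 (λ x y → y :- x := :- (x :- y)) refl x y)
                   (trans (cong ℚ.-_ x-y≡z) (sym (ℤtoℚ-neg z)))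
      where open +-*-Solver
  z≡0 : ∀ z → z ℤ.< + 1 → ℤ.- z ℤ.< + 1 → z ≡ + 0
  z≡0 (+ zero)   _                  _ = refl
  z≡0 (+ suc n)  (ℤ.+<+ (s≤s ()))   _
  z≡0 -[1+ n ]   _                  (ℤ.+<+ (s≤s ()))

0≤frac : ∀ q → 0ℚ ℚ.≤ frac q
0≤frac q = subst (ℚ._≤ frac q) (ℚ.+-inverseʳ (ℤtoℚ (ℚ.floor q)))
  (ℚ.+-monoˡ-≤ (ℚ.- ℤtoℚ (ℚ.floor q)) (floor-≤ q))

frac<1 : ∀ q → frac q ℚ.< 1ℚ
frac<1 q = subst (frac q ℚ.<_) (solve 2 (λ f o → f :+ o :- f := o) refl (ℤtoℚ (ℚ.floor q)) 1ℚ)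
  (ℚ.+-monoˡ-< (ℚ.- ℤtoℚ (ℚ.floor q)) (<-floor+1 q))
  where open +-*-Solver

frac-halfOpenUnit : ∀ q → HalfOpenUnit (frac q)
frac-halfOpenUnit q = 0≤frac q , frac<1 q

frac-integral : ∀ {q} → Integral q → frac q ≡ 0ℚ
frac-integral {q} q∈ℤ = halfOpenUnit-integral-diff⇒≡ (frac-halfOpenUnit q) (ℚ.≤-refl , ℚ.*<* (ℤ.+<+ (s≤s z≤n)))
  (subst Integral (solve 2 (λ q f → q :- (q :- f) := f :- con 0ℚ) refl q (frac q))
         (integral-- q∈ℤ (integral-q-frac q)))
  where open +-*-Solver

-- Finite sums

sumℚ≡sum : ∀ {n} (f : Fin n → ℚ) → sumℚ f ≡ sum f
sumℚ≡sum {zero}  f = refl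
sumℚ≡sum {suc n} f = cong (f zero ℚ.+_) (sumℚ≡sum (λ i → f (suc i)))

sum-zero : ∀ {n} {f : Fin n → ℚ} → (∀ i → f i ≡ 0ℚ) → sum f ≡ 0ℚ
sum-zero {n} f≗0 = trans (sum-cong-≗ f≗0) (sum-replicate-zero n)

sum-neg : ∀ {n} (f : Fin n → ℚ) → sum (λ i → ℚ.- f i) ≡ ℚ.- sum f
sum-neg {zero}  f = refl
sum-neg {suc n} f = trans (cong (ℚ.- f zero ℚ.+_) (sum-neg (λ i → f (suc i))))
                          (sym (ℚ.neg-distrib-+ (f zero) (sum (λ i → f (suc i)))))

sum-- : ∀ {n} (f g : Fin n → ℚ) → sum (λ i → f i ℚ.- g i) ≡ sum f ℚ.- sum g
sum-- f g = trans (∑-distrib-+ f (λ i → ℚ.- g i)) (cong (sum f ℚ.+_) (sum-neg g))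

sum-single : ∀ {n} (f : Fin n → ℚ) (s : Fin n) → (∀ j → j ≢ s → f j ≡ 0ℚ) → sum f ≡ f s
sum-single {suc n} f s f≡0 = begin
  sum f                                         ≡⟨ sum-remove {i = s} f ⟩
  f s ℚ.+ sum (λ j → f (Fin.punchIn s j))        ≡⟨ cong (f s ℚ.+_) (sum-zero (λ j → f≡0 _ (Fin.punchInᵢ≢i s j))) ⟩
  f s ℚ.+ 0ℚ                                     ≡⟨ ℚ.+-identityʳ (f s) ⟩
  f s                                           ∎
  where open ≡-Reasoning

δ : ∀ {n} → Fin n → Fin n → ℚ
δ s j with j Fin.≟ s
... | yes _ = 1ℚ
... | no  _ = 0ℚ

δ-diag : ∀ {n} (s : Fin n) → δ s s ≡ 1ℚ
δ-diag s with s Fin.≟ s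
... | yes _   = refl
... | no s≢s = ⊥-elim (s≢s refl)

δ-offdiag : ∀ {n} (s j : Fin n) → j ≢ s → δ s j ≡ 0ℚ
δ-offdiag s j j≢s with j Fin.≟ s
... | yes j≡s = ⊥-elim (j≢s j≡s)
... | no  _   = refl

integral-δ : ∀ {n} (s j : Fin n) → Integral (δ s j)
integral-δ s j with j Fin.≟ s
... | yes _ = + 1 , refl
... | no  _ = + 0 , refl

sum-δ* : ∀ {n} (s : Fin n) (f : Fin n → ℚ) → sum (λ j → δ s j ℚ.* f j) ≡ f s
sum-δ* s f = begin
  sum (λ j → δ s j ℚ.* f j)
    ≡⟨ sum-single _ s (λ j j≢s → trans (cong (ℚ._* f j) (δ-offdiag s j j≢s)) (ℚ.*-zeroˡ (f j))) ⟩
  δ s s ℚ.* f s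
    ≡⟨ trans (cong (ℚ._* f s) (δ-diag s)) (ℚ.*-identityˡ (f s)) ⟩
  f s ∎
  where open ≡-Reasoning

integral-sum : ∀ {n} {f : Fin n → ℚ} → (∀ i → Integral (f i)) → Integral (sum f)
integral-sum {zero}  _   = + 0 , refl
integral-sum {suc n} f∈ℤ = integral-+ (f∈ℤ zero) (integral-sum (λ i → f∈ℤ (suc i)))

ℕtoℚ-sumℕ : ∀ {n} (f : Fin n → ℕ) → ℕtoℚ (sumℕ f) ≡ sum (λ i → ℕtoℚ (f i))
ℕtoℚ-sumℕ {zero}  f = refl
ℕtoℚ-sumℕ {suc n} f = trans (ℕtoℚ-+ (f zero) _) (cong (ℕtoℚ (f zero) ℚ.+_) (ℕtoℚ-sumℕ (λ i → f (suc i))))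

ℤtoℚ-sumℤ : ∀ {n} (f : Fin n → ℤ) → ℤtoℚ (sumℤ f) ≡ sum (λ i → ℤtoℚ (f i))
ℤtoℚ-sumℤ {zero}  f = refl
ℤtoℚ-sumℤ {suc n} f = trans (ℤtoℚ-+ (f zero) _) (cong (ℤtoℚ (f zero) ℚ.+_) (ℤtoℚ-sumℤ (λ i → f (suc i))))

sumℕ≡0⇒≡0 : ∀ {n} (f : Fin n → ℕ) → sumℕ f ≡ 0 → ∀ i → f i ≡ 0
sumℕ≡0⇒≡0 f Σf≡0 zero    = ℕ.m+n≡0⇒m≡0 (f zero) Σf≡0
sumℕ≡0⇒≡0 f Σf≡0 (suc i) = sumℕ≡0⇒≡0 (λ i → f (suc i)) (ℕ.m+n≡0⇒n≡0 (f zero) Σf≡0) i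

sumℕ-zero : ∀ {n} (f : Fin n → ℕ) → (∀ i → f i ≡ 0) → sumℕ f ≡ 0
sumℕ-zero {zero}  f f≡0 = refl
sumℕ-zero {suc n} f f≡0 =
  trans (cong (_+ sumℕ (λ i → f (suc i))) (f≡0 zero)) (sumℕ-zero (λ i → f (suc i)) (λ i → f≡0 (suc i)))

-- Linear algebra over ℚ

∣p∣≡1+∣p-x∣ : ∀ {n} {p : Subset n} {x} → x ∈ p → ∣ p ∣ ≡ suc ∣ p - x ∣
∣p∣≡1+∣p-x∣ {p = inside ∷ p}  here      = cong (suc ∘ ∣_∣) (sym (p─⊥≡p p))
∣p∣≡1+∣p-x∣ {p = inside ∷ p}  (there x∈p) = cong suc (∣p∣≡1+∣p-x∣ x∈p)
∣p∣≡1+∣p-x∣ {p = outside ∷ p} (there x∈p) = ∣p∣≡1+∣p-x∣ x∈p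

∣p-x∣≤n : ∀ {n k} {p : Subset n} {x} → x ∈ p → ∣ p ∣ ≤ suc k → ∣ p - x ∣ ≤ k
∣p-x∣≤n x∈p |p|≤1+k = ℕ.≤-pred (subst (_≤ suc _) (∣p∣≡1+∣p-x∣ x∈p) |p|≤1+k)

∣p-x∣<∣q-y∣ : ∀ {n k} {p : Subset n} {q : Subset k} {x y} → x ∈ p → y ∈ q →
              ∣ p ∣ < ∣ q ∣ → ∣ p - x ∣ < ∣ q - y ∣
∣p-x∣<∣q-y∣ x∈p y∈q |p|<|q| = ℕ.≤-pred (subst₂ _<_ (∣p∣≡1+∣p-x∣ x∈p) (∣p∣≡1+∣p-x∣ y∈q) |p|<|q|)

x∉p-x : ∀ {n} (p : Subset n) x → x ∉ p - x
x∉p-x (_ ∷ p) (suc x) (there x∈p-x) = x∉p-x p x x∈p-x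

x∈p-y⇒x≢y : ∀ {n} {p : Subset n} {x y} → x ∈ p - y → x ≢ y
x∈p-y⇒x≢y {p = p} {y = y} x∈p-y refl = x∉p-x p y x∈p-y

x∈p-y⇒x∈p : ∀ {n} {p : Subset n} {x y} → x ∈ p - y → x ∈ p
x∈p-y⇒x∈p {p = p} = p─q⊆p p _

0<∣p∣⇒nonempty : ∀ {n} (p : Subset n) → 0 < ∣ p ∣ → Nonempty p
0<∣p∣⇒nonempty {n} p 0<∣p∣ with nonempty? p
... | yes p≢∅ = p≢∅
... | no  p≡∅ = ⊥-elim (ℕ.<-irrefl (sym (trans (cong ∣_∣ (Empty-unique p≡∅)) (∣⊥∣≡0 n))) 0<∣p∣)

Supported : ∀ {n} → Subset n → (Fin n → ℚ) → Set
Supported I x = ∀ i → i ∉ I → x i ≡ 0ℚ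

lincomb : ∀ {k n} → (Fin k → ℚ) → (Fin k → Fin n → ℚ) → Fin n → ℚ
lincomb c w i = sum (λ j → c j ℚ.* w j i)

lincomb-+ : ∀ {k n} (c c′ : Fin k → ℚ) (w : Fin k → Fin n → ℚ) i →
            lincomb (λ j → c j ℚ.+ c′ j) w i ≡ lincomb c w i ℚ.+ lincomb c′ w i
lincomb-+ c c′ w i = trans (sum-cong-≗ (λ j → ℚ.*-distribʳ-+ (w j i) (c j) (c′ j)))
                           (∑-distrib-+ (λ j → c j ℚ.* w j i) (λ j → c′ j ℚ.* w j i))

lincomb-- : ∀ {k n} (c c′ : Fin k → ℚ) (w : Fin k → Fin n → ℚ) i →
            lincomb (λ j → c j ℚ.- c′ j) w i ≡ lincomb c w i ℚ.- lincomb c′ w i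
lincomb-- c c′ w i = trans (sum-cong-≗ distrib) (sum-- (λ j → c j ℚ.* w j i) (λ j → c′ j ℚ.* w j i))
  where
  distrib : ∀ j → (c j ℚ.- c′ j) ℚ.* w j i ≡ c j ℚ.* w j i ℚ.- c′ j ℚ.* w j i
  distrib j = solve 3 (λ c c′ w → (c :- c′) :* w := c :* w :- c′ :* w) refl (c j) (c′ j) (w j i)
    where open +-*-Solver

LinearlyIndependent : ∀ {k n} → (Fin k → Fin n → ℚ) → Set
LinearlyIndependent w = ∀ c → (∀ i → lincomb c w i ≡ 0ℚ) → ∀ j → c j ≡ 0ℚ

record LinearDependence {k n} (w : Fin k → Fin n → ℚ) (A : Subset k) : Set where
  field
    coeff      : Fin k → ℚ
    supported  : Supported A coeff
    relation   : ∀ i → lincomb coeff w i ≡ 0ℚ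
    index      : Fin k
    index∈A    : index ∈ A
    nontrivial : coeff index ≢ 0ℚ

zeroVector-dependence : ∀ {k n} (w : Fin k → Fin n → ℚ) {A : Subset k} {s} →
                        s ∈ A → (∀ i → w s i ≡ 0ℚ) → LinearDependence w A
zeroVector-dependence w {A} {s} s∈A ws≡0 = record
  { coeff      = δ s
  ; supported  = λ j j∉A → δ-offdiag s j (λ { refl → j∉A s∈A })
  ; relation   = λ i → trans (sum-δ* s (λ j → w j i)) (ws≡0 i)
  ; index      = s
  ; index∈A    = s∈A
  ; nontrivial = λ δss≡0 → ℚ.1≢0 (trans (sym (δ-diag s)) δss≡0)
  }

supported-remove : ∀ {n} {I : Subset n} {x : Fin n → ℚ} {i} → Supported I x → x i ≡ 0ℚ → Supported (I - i) x
supported-remove {i = i} x-supp xᵢ≡0 k k∉I-i with k Fin.≟ i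
... | yes refl = xᵢ≡0
... | no  k≢i  = x-supp k (λ k∈I → k∉I-i (x∈p∧x≢y⇒x∈p-y k∈I k≢i))

module _ {k n} (w : Fin k → Fin n → ℚ) {A : Subset k} {s} (s∈A : s ∈ A) (t : Fin k → ℚ) where

  shear : Fin k → Fin n → ℚ
  shear j i = w j i ℚ.- t j ℚ.* w s i

  shear-supported : ∀ {I : Subset n} {i j} → Supported I (w j) → Supported I (w s) → shear j i ≡ 0ℚ →
                    Supported (I - i) (shear j)
  shear-supported {j = j} wⱼ-supp wₛ-supp shearᵢ≡0 = supported-remove outside-I shearᵢ≡0
    where
    outside-I : Supported _ (shear j)
    outside-I k k∉I = trans (cong₂ (λ a b → a ℚ.- t j ℚ.* b) (wⱼ-supp k k∉I) (wₛ-supp k k∉I))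
                            (cong (ℚ._-_ 0ℚ) (ℚ.*-zeroʳ (t j)))

  unshear-dependence : LinearDependence shear (A - s) → LinearDependence w A
  unshear-dependence dep = record
    { coeff      = c
    ; supported  = c-supported
    ; relation   = c-relation
    ; index      = index
    ; index∈A    = x∈p-y⇒x∈p index∈A
    ; nontrivial = λ cᵢ≡0 → nontrivial (trans (sym (c≡coeff (x∈p-y⇒x≢y index∈A))) cᵢ≡0)
    }
    where
    open LinearDependence dep
    T : ℚ
    T = ℚ.- sum (λ j → coeff j ℚ.* t j)
    c : Fin k → ℚ
    c j = coeff j ℚ.+ δ s j ℚ.* T
    c≡coeff : ∀ {j} → j ≢ s → c j ≡ coeff j
    c≡coeff {j} j≢s = trans (cong (λ d → coeff j ℚ.+ d ℚ.* T) (δ-offdiag s j j≢s))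
                            (trans (cong (coeff j ℚ.+_) (ℚ.*-zeroˡ T)) (ℚ.+-identityʳ (coeff j)))
    c-supported : Supported A c
    c-supported j j∉A = trans (c≡coeff j≢s) (supported j (j∉A ∘ x∈p-y⇒x∈p))
      where
      j≢s : j ≢ s
      j≢s refl = j∉A s∈A
    c-relation : ∀ i → lincomb c w i ≡ 0ℚ
    c-relation i = begin
      lincomb c w i
        ≡⟨ lincomb-+ coeff (λ j → δ s j ℚ.* T) w i ⟩
      lincomb coeff w i ℚ.+ sum (λ j → δ s j ℚ.* T ℚ.* w j i)
        ≡⟨ cong (lincomb coeff w i ℚ.+_) (trans (sum-cong-≗ (λ j → ℚ.*-assoc (δ s j) T (w j i)))
                                                (sum-δ* s (λ j → T ℚ.* w j i))) ⟩
      lincomb coeff w i ℚ.+ T ℚ.* w s i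
        ≡⟨ cong (lincomb coeff w i ℚ.+_) (trans (sym (ℚ.neg-distribˡ-* (sum (λ j → coeff j ℚ.* t j)) (w s i)))
                                                (cong ℚ.-_ (*-distribʳ-sum (w s i) (λ j → coeff j ℚ.* t j)))) ⟩
      lincomb coeff w i ℚ.- sum (λ j → coeff j ℚ.* t j ℚ.* w s i)
        ≡⟨ sym (sum-- (λ j → coeff j ℚ.* w j i) (λ j → coeff j ℚ.* t j ℚ.* w s i)) ⟩
      sum (λ j → coeff j ℚ.* w j i ℚ.- coeff j ℚ.* t j ℚ.* w s i)
        ≡⟨ sum-cong-≗ (λ j → solve 4 (λ c w t v → c :* w :- c :* t :* v := c :* (w :- t :* v))
                                       refl (coeff j) (w j i) (t j) (w s i)) ⟩
      lincomb coeff shear i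
        ≡⟨ relation i ⟩
      0ℚ ∎
      where
      open ≡-Reasoning
      open +-*-Solver

x*y≡0⇒y≡0 : ∀ {x y} → x ≢ 0ℚ → x ℚ.* y ≡ 0ℚ → y ≡ 0ℚ
x*y≡0⇒y≡0 {x} {y} x≢0 x*y≡0 = begin
  y                          ≡⟨ sym (ℚ.*-identityˡ y) ⟩
  1ℚ ℚ.* y                   ≡⟨ cong (ℚ._* y) (sym (ℚ.*-inverseˡ x)) ⟩
  ℚ.1/ x ℚ.* x ℚ.* y         ≡⟨ ℚ.*-assoc (ℚ.1/ x) x y ⟩
  ℚ.1/ x ℚ.* (x ℚ.* y)       ≡⟨ cong (ℚ.1/ x ℚ.*_) x*y≡0 ⟩
  ℚ.1/ x ℚ.* 0ℚ              ≡⟨ ℚ.*-zeroʳ (ℚ.1/ x) ⟩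
  0ℚ                         ∎
  where
  open ≡-Reasoning
  instance
    _ : ℚ.NonZero x
    _ = ℚ.≢-nonZero x≢0

x-x/y*y≡0 : ∀ x y .{{_ : ℚ.NonZero y}} → x ℚ.- x ℚ.* ℚ.1/ y ℚ.* y ≡ 0ℚ
x-x/y*y≡0 x y = begin
  x ℚ.- x ℚ.* ℚ.1/ y ℚ.* y     ≡⟨ cong (ℚ._-_ x) (ℚ.*-assoc x (ℚ.1/ y) y) ⟩
  x ℚ.- x ℚ.* (ℚ.1/ y ℚ.* y)   ≡⟨ cong (λ r → x ℚ.- x ℚ.* r) (ℚ.*-inverseˡ y) ⟩
  x ℚ.- x ℚ.* 1ℚ               ≡⟨ cong (ℚ._-_ x) (ℚ.*-identityʳ x) ⟩
  x ℚ.- x                      ≡⟨ ℚ.+-inverseʳ x ⟩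
  0ℚ                           ∎
  where open ≡-Reasoning

-- Gaussian elimination on the coordinates in I.
dependent : ∀ d {k n} (w : Fin k → Fin n → ℚ) (A : Subset k) (I : Subset n) →
            ∣ I ∣ ≤ d → ∣ I ∣ < ∣ A ∣ → (∀ j → j ∈ A → Supported I (w j)) → LinearDependence w A
dependent d w A I _ |I|<|A| supp with nonempty? I | 0<∣p∣⇒nonempty A (ℕ.≤-<-trans z≤n |I|<|A|)
... | no I≢∅ | (s , s∈A) = zeroVector-dependence w s∈A (λ i → supp s s∈A i (λ i∈I → I≢∅ (i , i∈I)))
dependent zero w A I |I|≤0 _ _ | yes (i , i∈I) | _ = ⊥-elim (ℕ.n≮0 (ℕ.<-≤-trans (x∈p⇒∣p-x∣<∣p∣ i∈I) |I|≤0))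
dependent (suc d) w A I |I|≤1+d |I|<|A| supp | yes (i , i∈I) | _
  with Fin.any? (λ s → (s ∈? A) ×-dec ¬? (w s i ℚ.≟ 0ℚ))
... | no none = dependent d w A (I - i) (∣p-x∣≤n i∈I |I|≤1+d) (ℕ.<-trans (x∈p⇒∣p-x∣<∣p∣ i∈I) |I|<|A|)
  (λ j j∈A → supported-remove (supp j j∈A)
                (decidable-stable (w j i ℚ.≟ 0ℚ) (λ wⱼᵢ≢0 → none (j , j∈A , wⱼᵢ≢0))))
... | yes (s , s∈A , wₛᵢ≢0) = unshear-dependence w s∈A t
  (dependent d (shear w s∈A t) (A - s) (I - i) (∣p-x∣≤n i∈I |I|≤1+d) (∣p-x∣<∣q-y∣ i∈I s∈A |I|<|A|)
     (λ j j∈A-s → shear-supported w s∈A t (supp j (x∈p-y⇒x∈p j∈A-s)) (supp s s∈A) (x-x/y*y≡0 (w j i) (w s i))))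
  where
  instance
    _ : ℚ.NonZero (w s i)
    _ = ℚ.≢-nonZero wₛᵢ≢0
  t : Fin _ → ℚ
  t j = w j i ℚ.* ℚ.1/ w s i

dependence⇒spanned : ∀ {k n} {w : Fin k → Fin n → ℚ} {A : Subset k} {x : Fin n → ℚ} →
                     LinearlyIndependent w → LinearDependence (x Vector.∷ w) (inside ∷ A) →
                     ∃[ c ] Supported A c × (∀ i → x i ≡ lincomb c w i)
dependence⇒spanned {k} {w = w} {x = x} indep dep with LinearDependence.coeff dep zero ℚ.≟ 0ℚ
... | yes c₀≡0 = ⊥-elim (nontrivial (coeff≡0 index))
  where
  open LinearDependence dep
  rest-relation : ∀ i → lincomb (coeff ∘ suc) w i ≡ 0ℚ
  rest-relation i = begin
    lincomb (coeff ∘ suc) w i                         ≡⟨ sym (ℚ.+-identityˡ _) ⟩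
    0ℚ ℚ.+ lincomb (coeff ∘ suc) w i                  ≡⟨ cong (ℚ._+ lincomb (coeff ∘ suc) w i)
                                                            (sym (trans (cong (ℚ._* x i) c₀≡0) (ℚ.*-zeroˡ (x i)))) ⟩
    coeff zero ℚ.* x i ℚ.+ lincomb (coeff ∘ suc) w i  ≡⟨ relation i ⟩
    0ℚ                                                ∎
    where open ≡-Reasoning
  coeff≡0 : ∀ j → coeff j ≡ 0ℚ
  coeff≡0 zero    = c₀≡0
  coeff≡0 (suc j) = indep (coeff ∘ suc) rest-relation j
... | no c₀≢0 = c , c-supp , x≡
  where
  open LinearDependence dep
  instance
    _ : ℚ.NonZero (coeff zero)
    _ = ℚ.≢-nonZero c₀≢0
  r : ℚ
  r = ℚ.1/ coeff zero
  c : Fin k → ℚ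
  c j = ℚ.- coeff (suc j) ℚ.* r
  c-supp : Supported _ c
  c-supp j j∉A = trans (cong (λ a → ℚ.- a ℚ.* r) (supported (suc j) (λ { (there j∈A) → j∉A j∈A }))) (ℚ.*-zeroˡ r)
  x≡ : ∀ i → x i ≡ lincomb c w i
  x≡ i = sym (begin
    sum (λ j → ℚ.- coeff (suc j) ℚ.* r ℚ.* w j i)
      ≡⟨ sum-cong-≗ (λ j → solve 3 (λ a r b → :- a :* r :* b := (:- r) :* (a :* b)) refl (coeff (suc j)) r (w j i)) ⟩
    sum (λ j → (ℚ.- r) ℚ.* (coeff (suc j) ℚ.* w j i))
      ≡⟨ sym (*-distribˡ-sum (ℚ.- r) (λ j → coeff (suc j) ℚ.* w j i)) ⟩
    (ℚ.- r) ℚ.* lincomb (coeff ∘ suc) w i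
      ≡⟨ cong ((ℚ.- r) ℚ.*_) (p+q≡0⇒q≡-p _ _ (relation i)) ⟩
    (ℚ.- r) ℚ.* (ℚ.- (coeff zero ℚ.* x i))
      ≡⟨ solve 3 (λ r g x → (:- r) :* (:- (g :* x)) := (r :* g) :* x) refl r (coeff zero) (x i) ⟩
    (r ℚ.* coeff zero) ℚ.* x i
      ≡⟨ cong (ℚ._* x i) (ℚ.*-inverseˡ (coeff zero)) ⟩
    1ℚ ℚ.* x i
      ≡⟨ ℚ.*-identityˡ (x i) ⟩
    x i ∎)
    where
    open ≡-Reasoning
    open +-*-Solver

spanned : ∀ {k n} (w : Fin k → Fin n → ℚ) (A : Subset k) (I : Subset n) →
          LinearlyIndependent w → ∣ I ∣ ≤ ∣ A ∣ → (∀ j → j ∈ A → Supported I (w j)) →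
          ∀ x → Supported I x → ∃[ c ] Supported A c × (∀ i → x i ≡ lincomb c w i)
spanned w A I indep |I|≤|A| supp x x-supp =
  dependence⇒spanned indep (dependent ∣ I ∣ (x Vector.∷ w) (inside ∷ A) I ℕ.≤-refl (s≤s |I|≤|A|) supp⁺)
  where
  supp⁺ : ∀ j → j ∈ inside ∷ A → Supported I ((x Vector.∷ w) j)
  supp⁺ zero    _           = x-supp
  supp⁺ (suc j) (there j∈A) = supp j j∈A

restrict : ∀ {n} → Subset n → (Fin n → ℚ) → Fin n → ℚ
restrict X f j with j ∈? X
... | yes _ = f j
... | no  _ = 0ℚ

restrict-∈ : ∀ {n} {X : Subset n} (f : Fin n → ℚ) {j} → j ∈ X → restrict X f j ≡ f j
restrict-∈ {X = X} f {j} j∈X with j ∈? X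
... | yes _   = refl
... | no  j∉X = ⊥-elim (j∉X j∈X)

restrict-∉ : ∀ {n} {X : Subset n} (f : Fin n → ℚ) {j} → j ∉ X → restrict X f j ≡ 0ℚ
restrict-∉ {X = X} f {j} j∉X with j ∈? X
... | yes j∈X = ⊥-elim (j∉X j∈X)
... | no  _   = refl

integral-restrict : ∀ {n} {X : Subset n} {f : Fin n → ℚ} → (∀ j → Integral (f j)) → ∀ j → Integral (restrict X f j)
integral-restrict {X = X} f∈ℤ j with j ∈? X
... | yes _ = f∈ℤ j
... | no  _ = + 0 , refl

lincomb-supported : ∀ {k n} {c : Fin k → ℚ} {w : Fin k → Fin n → ℚ} {A : Subset k} {I : Subset n} →
                    Supported A c → (∀ j → j ∈ A → Supported I (w j)) → Supported I (lincomb c w)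
lincomb-supported {c = c} {w} {A} c-supp w-supp i i∉I = sum-zero termwise
  where
  termwise : ∀ j → c j ℚ.* w j i ≡ 0ℚ
  termwise j with j ∈? A
  ... | yes j∈A = trans (cong (c j ℚ.*_) (w-supp j j∈A i i∉I)) (ℚ.*-zeroʳ (c j))
  ... | no  j∉A = trans (cong (ℚ._* w j i) (c-supp j j∉A)) (ℚ.*-zeroˡ (w j i))

infix 7 _·_
_·_ : ∀ {n} → (Fin n → ℚ) → (Fin n → ℚ) → ℚ
w · x = sum (λ i → w i ℚ.* x i)

·-congʳ : ∀ {n} (w : Fin n → ℚ) {x y : Fin n → ℚ} → (∀ i → x i ≡ y i) → w · x ≡ w · y
·-congʳ w x≗y = sum-cong-≗ (λ i → cong (w i ℚ.*_) (x≗y i))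

·-distrib-- : ∀ {n} (w x y : Fin n → ℚ) → w · (λ i → x i ℚ.- y i) ≡ w · x ℚ.- w · y
·-distrib-- w x y = trans (sum-cong-≗ (λ i → solve 3 (λ w x y → w :* (x :- y) := w :* x :- w :* y) refl (w i) (x i) (y i)))
                          (sum-- (λ i → w i ℚ.* x i) (λ i → w i ℚ.* y i))
  where open +-*-Solver

·-lincomb : ∀ {k n} (w : Fin n → ℚ) (c : Fin k → ℚ) (u : Fin k → Fin n → ℚ) →
            w · lincomb c u ≡ sum (λ j → c j ℚ.* (w · u j))
·-lincomb w c u = begin
  sum (λ i → w i ℚ.* sum (λ j → c j ℚ.* u j i))
    ≡⟨ sum-cong-≗ (λ i → *-distribˡ-sum (w i) (λ j → c j ℚ.* u j i)) ⟩
  sum (λ i → sum (λ j → w i ℚ.* (c j ℚ.* u j i)))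
    ≡⟨ ∑-comm (λ i j → w i ℚ.* (c j ℚ.* u j i)) ⟩
  sum (λ j → sum (λ i → w i ℚ.* (c j ℚ.* u j i)))
    ≡⟨ sum-cong-≗ (λ j → trans (sum-cong-≗ (λ i → regroup (w i) (c j) (u j i)))
                               (sym (*-distribˡ-sum (c j) (λ i → w i ℚ.* u j i)))) ⟩
  sum (λ j → c j ℚ.* (w · u j)) ∎
  where
  open ≡-Reasoning
  regroup : ∀ w c u → w ℚ.* (c ℚ.* u) ≡ c ℚ.* (w ℚ.* u)
  regroup = solve 3 (λ w c u → w :* (c :* u) := c :* (w :* u)) refl
    where open +-*-Solver

·-δ : ∀ {n} (w : Fin n → ℚ) i → w · δ i ≡ w i
·-δ w i = trans (sum-cong-≗ (λ k → ℚ.*-comm (w k) (δ i k))) (sum-δ* i w)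

-- Counting in lists

module _ {A B : Set} (_≟_ : DecidableEquality B) (f : A → B) where

  private
    length-filter-≢ : ∀ {b} ys → b ∈L ys → List.length (List.filter (λ y → ¬? (y ≟ b)) ys) < List.length ys
    length-filter-≢ {b} ys b∈ys = List.filter-notAll (λ y → ¬? (y ≟ b)) ys (Any.map (λ b≡y y≢b → y≢b (sym b≡y)) b∈ys)

  InjectiveOn : List A → Set
  InjectiveOn xs = ∀ {x x′} → x ∈L xs → x′ ∈L xs → f x ≡ f x′ → x ≡ x′

  injection-length-≤ : ∀ xs ys → Unique xs → InjectiveOn xs → (∀ {x} → x ∈L xs → f x ∈L ys) →
                       List.length xs ≤ List.length ys
  injection-length-≤ []       ys _               _   _     = z≤n
  injection-length-≤ (x ∷ xs) ys (x∉xs ∷ unique) inj maps =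
    ℕ.<-≤-trans (s≤s (injection-length-≤ xs ys′ unique (λ p q → inj (there p) (there q)) maps′))
                (length-filter-≢ ys (maps (here refl)))
    where
    ys′ = List.filter (λ y → ¬? (y ≟ f x)) ys
    maps′ : ∀ {x′} → x′ ∈L xs → f x′ ∈L ys′
    maps′ x′∈xs = ∈-filter⁺ (λ y → ¬? (y ≟ f x)) (maps (there x′∈xs))
                    (λ fx′≡fx → All.lookup x∉xs x′∈xs (inj (here refl) (there x′∈xs) (sym fx′≡fx)))

  injection-length-< : ∀ xs ys → Unique xs → InjectiveOn xs → (∀ {x} → x ∈L xs → f x ∈L ys) →
                       ∀ {b} → b ∈L ys → (∀ {x} → x ∈L xs → f x ≢ b) → List.length xs < List.length ys
  injection-length-< xs ys unique inj maps {b} b∈ys misses =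
    ℕ.≤-<-trans (injection-length-≤ xs (List.filter (λ y → ¬? (y ≟ b)) ys) unique inj
                   (λ x∈xs → ∈-filter⁺ (λ y → ¬? (y ≟ b)) (maps x∈xs) (misses x∈xs)))
                (length-filter-≢ ys b∈ys)

find-just : ∀ {A : Set} {P : A → Set} (P? : U.Decidable P) xs {x} → x ∈L xs → P x →
            ∃[ r ] List.find P? xs ≡ just r × r ∈L xs × P r
find-just P? (y ∷ ys) x∈ Px with P? y | x∈
... | yes Py  | _          = y , refl , here refl , Py
... | no  ¬Py | here refl  = ⊥-elim (¬Py Px)
... | no  _   | there x∈ys with find-just P? ys x∈ys Px
...   | r , found , r∈ys , Pr = r , found , there r∈ys , Pr

module _ {A B : Set} (_≟_ : DecidableEquality B) (f : A → B) (xs : List A) where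

  representative : A → A
  representative x = fromMaybe x (List.find (λ y → f y ≟ f x) xs)

  representative-spec : ∀ {x} → x ∈L xs → representative x ∈L xs × f (representative x) ≡ f x
  representative-spec {x} x∈xs with find-just (λ y → f y ≟ f x) xs x∈xs refl
  ... | r , found , r∈xs , fr≡fx rewrite found = r∈xs , fr≡fx

  representative-cong : ∀ {x x′} → x ∈L xs → f x ≡ f x′ → representative x ≡ representative x′
  representative-cong {x} {x′} x∈xs fx≡fx′ with find-just (λ y → f y ≟ f x) xs x∈xs refl
  ... | r , found , _ , _ rewrite sym fx≡fx′ | found = refl

length-cartesianProduct : ∀ {A B : Set} (xs : List A) (ys : List B) →
                          List.length (List.cartesianProduct xs ys) ≡ List.length xs * List.length ys
length-cartesianProduct []       ys = refl
length-cartesianProduct (x ∷ xs) ys = trans (List.length-++ (List.map (x ,_) ys))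
  (cong₂ _+_ (List.length-map (x ,_) ys) (length-cartesianProduct xs ys))

-- Bézout and divisibility

ℤ-shift : ∀ a b c → a ℤ.+ b ≡ c → a ≡ c ℤ.- b
ℤ-shift a b c a+b≡c = trans (solve 2 (λ a b → a := (a :+ b) :- b) refl a b) (cong (ℤ._- b) a+b≡c)
  where open ℤ-Solver

pos-lift : ∀ d x y m k → d + y * k ≡ x * m → + d ℤ.+ + y ℤ.* + k ≡ + x ℤ.* + m
pos-lift d x y m k eq =
  trans (cong (ℤ._+_ (+ d)) (sym (ℤ.pos-* y k))) (trans (cong +_ eq) (ℤ.pos-* x m))

bezoutℤ : ∀ m k → ∃[ x ] ∃[ y ] + ℕ.gcd m k ≡ x ℤ.* + m ℤ.+ y ℤ.* + k
bezoutℤ m k with Bézout.identity (ℕ.gcd-GCD m k)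
... | Bézout.+- x y eq = + x , ℤ.- + y ,
  trans (ℤ-shift (+ ℕ.gcd m k) (+ y ℤ.* + k) (+ x ℤ.* + m) (pos-lift _ x y m k eq))
        (solve 4 (λ X M Y K → X :* M :- Y :* K := X :* M :+ (:- Y) :* K) refl (+ x) (+ m) (+ y) (+ k))
  where open ℤ-Solver
... | Bézout.-+ x y eq = ℤ.- + x , + y ,
  trans (ℤ-shift (+ ℕ.gcd m k) (+ x ℤ.* + m) (+ y ℤ.* + k) (pos-lift _ y x k m eq))
        (solve 4 (λ X M Y K → Y :* K :- X :* M := (:- X) :* M :+ Y :* K) refl (+ x) (+ m) (+ y) (+ k))
  where open ℤ-Solver

record BezoutOn {n} (b : Fin n → ℕ) (I : Subset n) : Set where
  field
    gcd       : ℕ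
    gcd∣b     : ∀ i → i ∈ I → gcd ∣ b i
    coeff     : Fin n → ℤ
    supported : ∀ i → i ∉ I → coeff i ≡ + 0
    identity  : sumℤ (λ i → + b i ℤ.* coeff i) ≡ + gcd

bezoutOn : ∀ {n} (b : Fin n → ℕ) (I : Subset n) → BezoutOn b I
bezoutOn {zero}  b []            = record
  { gcd = 0 ; gcd∣b = λ _ () ; coeff = λ () ; supported = λ () ; identity = refl }
bezoutOn {suc n} b (outside ∷ I) = record
  { gcd       = gcd
  ; gcd∣b     = λ { (suc i) (there i∈I) → gcd∣b i i∈I }
  ; coeff     = + 0 Vector.∷ coeff
  ; supported = λ { zero _ → refl ; (suc i) i∉I → supported i (i∉I ∘ there) }
  ; identity  = trans (cong (ℤ._+ sumℤ (λ i → + b (suc i) ℤ.* coeff i)) (ℤ.*-zeroʳ (+ b zero)))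
                      (trans (ℤ.+-identityˡ _) identity)
  }
  where open BezoutOn (bezoutOn (b ∘ suc) I)
bezoutOn {suc n} b (inside ∷ I)  = record
  { gcd       = ℕ.gcd (b zero) gcd
  ; gcd∣b     = λ { zero _ → ℕ.gcd[m,n]∣m (b zero) gcd
                  ; (suc i) (there i∈I) → ∣-trans (ℕ.gcd[m,n]∣n (b zero) gcd) (gcd∣b i i∈I) }
  ; coeff     = x Vector.∷ (λ i → y ℤ.* coeff i)
  ; supported = λ { zero i∉I → ⊥-elim (i∉I here)
                  ; (suc i) i∉I → trans (cong (y ℤ.*_) (supported i (i∉I ∘ there))) (ℤ.*-zeroʳ y) }
  ; identity  = begin
      + b zero ℤ.* x ℤ.+ sumℤ (λ i → + b (suc i) ℤ.* (y ℤ.* coeff i))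
        ≡⟨ cong (ℤ._+_ (+ b zero ℤ.* x)) (trans (sumℤ-cong (λ i → solve 3 (λ B Y C → B :* (Y :* C) := Y :* (B :* C))
                                                                     refl (+ b (suc i)) y (coeff i)))
                                           (sym (*-distribˡ-sumℤ y (λ i → + b (suc i) ℤ.* coeff i)))) ⟩
      + b zero ℤ.* x ℤ.+ y ℤ.* sumℤ (λ i → + b (suc i) ℤ.* coeff i)
        ≡⟨ cong (λ s → + b zero ℤ.* x ℤ.+ y ℤ.* s) identity ⟩
      + b zero ℤ.* x ℤ.+ y ℤ.* + gcd
        ≡⟨ cong (ℤ._+ y ℤ.* + gcd) (ℤ.*-comm (+ b zero) x) ⟩
      x ℤ.* + b zero ℤ.+ y ℤ.* + gcd
        ≡⟨ sym gcd≡ ⟩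
      + ℕ.gcd (b zero) gcd ∎
  }
  where
  open BezoutOn (bezoutOn (b ∘ suc) I)
  open ≡-Reasoning
  open ℤ-Solver
  x = proj₁ (bezoutℤ (b zero) gcd)
  y = proj₁ (proj₂ (bezoutℤ (b zero) gcd))
  gcd≡ = proj₂ (proj₂ (bezoutℤ (b zero) gcd))

primitiveOn⇒bezout : ∀ {n} {I : Subset n} {b : Fin n → ℕ} → PrimitiveOn I b →
                     ∃[ y ] (∀ i → i ∉ I → y i ≡ + 0) × sumℤ (λ i → + b i ℤ.* y i) ≡ + 1
primitiveOn⇒bezout {I = I} {b} prim =
  coeff , supported , trans identity (cong +_ (prim gcd gcd∣b))
  where open BezoutOn (bezoutOn b I)

proportional-on : ∀ {n} {I : Subset n} {a b : Fin n → ℕ} {N Nτ : ℕ} → PrimitiveOn I b → N ≢ 0 →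
                  (∀ i → i ∈ I → a i * N ≡ b i * Nτ) →
                  ∃[ s ] Nτ ≡ s * N × (∀ i → i ∈ I → a i ≡ s * b i)
proportional-on {I = I} {a} {b} {N} {Nτ} prim N≢0 a*N≡b*Nτ = s , Nτ≡s*N , a≡s*b
  where
  instance
    _ : ℕ.NonZero N
    _ = ℕ.≢-nonZero N≢0
  y = proj₁ (primitiveOn⇒bezout prim)
  y-supported = proj₁ (proj₂ (primitiveOn⇒bezout prim))
  b·y≡1 = proj₂ (proj₂ (primitiveOn⇒bezout prim))
  Z : ℤ
  Z = sumℤ (λ i → + a i ℤ.* y i)
  termwise : ∀ i → + N ℤ.* (+ a i ℤ.* y i) ≡ + Nτ ℤ.* (+ b i ℤ.* y i)
  termwise i with i ∈? I
  ... | yes i∈I = begin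
    + N ℤ.* (+ a i ℤ.* y i)   ≡⟨ solve 3 (λ N A Y → N :* (A :* Y) := (A :* N) :* Y) refl (+ N) (+ a i) (y i) ⟩
    (+ a i ℤ.* + N) ℤ.* y i   ≡⟨ cong (ℤ._* y i) (trans (sym (ℤ.pos-* (a i) N))
                                   (trans (cong +_ (a*N≡b*Nτ i i∈I)) (ℤ.pos-* (b i) Nτ))) ⟩
    (+ b i ℤ.* + Nτ) ℤ.* y i  ≡⟨ solve 3 (λ B T Y → (B :* T) :* Y := T :* (B :* Y)) refl (+ b i) (+ Nτ) (y i) ⟩
    + Nτ ℤ.* (+ b i ℤ.* y i)  ∎
    where
    open ≡-Reasoning
    open ℤ-Solver
  ... | no i∉I rewrite y-supported i i∉I =
    trans (cong (+ N ℤ.*_) (ℤ.*-zeroʳ (+ a i))) (trans (ℤ.*-zeroʳ (+ N))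
      (sym (trans (cong (+ Nτ ℤ.*_) (ℤ.*-zeroʳ (+ b i))) (ℤ.*-zeroʳ (+ Nτ)))))
  N*Z≡Nτ : + N ℤ.* Z ≡ + Nτ
  N*Z≡Nτ = begin
    + N ℤ.* Z                                  ≡⟨ *-distribˡ-sumℤ (+ N) (λ i → + a i ℤ.* y i) ⟩
    sumℤ (λ i → + N ℤ.* (+ a i ℤ.* y i))       ≡⟨ sumℤ-cong termwise ⟩
    sumℤ (λ i → + Nτ ℤ.* (+ b i ℤ.* y i))      ≡⟨ sym (*-distribˡ-sumℤ (+ Nτ) (λ i → + b i ℤ.* y i)) ⟩
    + Nτ ℤ.* sumℤ (λ i → + b i ℤ.* y i)        ≡⟨ cong (+ Nτ ℤ.*_) b·y≡1 ⟩
    + Nτ ℤ.* + 1                               ≡⟨ ℤ.*-identityʳ (+ Nτ) ⟩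
    + Nτ                                       ∎
    where open ≡-Reasoning
  s : ℕ
  s = ℤ.∣ Z ∣
  Nτ≡s*N : Nτ ≡ s * N
  Nτ≡s*N = trans (cong ℤ.∣_∣ (sym N*Z≡Nτ)) (trans (ℤ.abs-* (+ N) Z) (ℕ.*-comm N s))
  a≡s*b : ∀ i → i ∈ I → a i ≡ s * b i
  a≡s*b i i∈I = ℕ.*-cancelʳ-≡ (a i) (s * b i) N (begin
    a i * N        ≡⟨ a*N≡b*Nτ i i∈I ⟩
    b i * Nτ       ≡⟨ cong (b i *_) Nτ≡s*N ⟩
    b i * (s * N)  ≡⟨ solve 3 (λ B S N → B :* (S :* N) := S :* B :* N) refl (b i) s N ⟩
    s * b i * N    ∎)
    where
    open ≡-Reasoning
    open ℕ-Solver

infix 4 _∣ℚ_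
_∣ℚ_ : ℕ → ℚ → Set
s ∣ℚ q = ∃[ z ] q ≡ ℕtoℚ s ℚ.* ℤtoℚ z

∣ℚ-+ : ∀ {s p q} → s ∣ℚ p → s ∣ℚ q → s ∣ℚ p ℚ.+ q
∣ℚ-+ {s} (x , refl) (y , refl) =
  x ℤ.+ y , trans (sym (ℚ.*-distribˡ-+ (ℕtoℚ s) (ℤtoℚ x) (ℤtoℚ y))) (cong (ℕtoℚ s ℚ.*_) (sym (ℤtoℚ-+ x y)))

∣ℚ-* : ∀ {s q} → Integral q → s ∣ℚ ℕtoℚ s ℚ.* q
∣ℚ-* (z , refl) = z , refl

∣ℚ⇒∣ : ∀ {s m} → s ∣ℚ ℕtoℚ m → s ∣ m
∣ℚ⇒∣ {s} {m} (z , m≡s*z) = divides ℤ.∣ z ∣ (begin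
  m                    ≡⟨ cong ℤ.∣_∣ (ℤtoℚ-injective {+ m} {+ s ℤ.* z} (trans m≡s*z (sym (ℤtoℚ-* (+ s) z)))) ⟩
  ℤ.∣ + s ℤ.* z ∣      ≡⟨ ℤ.abs-* (+ s) z ⟩
  s * ℤ.∣ z ∣          ≡⟨ ℕ.*-comm s ℤ.∣ z ∣ ⟩
  ℤ.∣ z ∣ * s          ∎)
  where open ≡-Reasoning

-- Lattice simplices

ℕᵛ : ∀ {n} → (Fin n → ℕ) → Fin n → ℚ
ℕᵛ b i = ℕtoℚ (b i)

ℤᵛ : ∀ {n} → Vec ℤ n → Fin n → ℚ
ℤᵛ p i = ℤtoℚ (lookup p i)

infixl 6 _+ᶻ_ _-ᶻ_
_+ᶻ_ _-ᶻ_ : ∀ {n} → Vec ℤ n → Vec ℤ n → Vec ℤ n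
p +ᶻ q = Vec.zipWith ℤ._+_ p q
p -ᶻ q = Vec.zipWith ℤ._-_ p q

ℤᵛ-+ : ∀ {n} (p q : Vec ℤ n) i → ℤᵛ (p +ᶻ q) i ≡ ℤᵛ p i ℚ.+ ℤᵛ q i
ℤᵛ-+ p q i = trans (cong ℤtoℚ (Vec.lookup-zipWith ℤ._+_ i p q)) (ℤtoℚ-+ (lookup p i) (lookup q i))

ℤᵛ-- : ∀ {n} (p q : Vec ℤ n) i → ℤᵛ (p -ᶻ q) i ≡ ℤᵛ p i ℚ.- ℤᵛ q i
ℤᵛ-- p q i = trans (cong ℤtoℚ (Vec.lookup-zipWith ℤ._-_ i p q)) (ℤtoℚ-- (lookup p i) (lookup q i))

infixr 7 _•ᶻ_
_•ᶻ_ : ∀ {n} → ℕ → (Fin n → ℤ) → Vec ℤ n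
k •ᶻ y = tabulate (λ i → + k ℤ.* y i)

ℤᵛ-•ᶻ : ∀ {n} k (y : Fin n → ℤ) i → ℤᵛ (k •ᶻ y) i ≡ ℕtoℚ k ℚ.* ℤtoℚ (y i)
ℤᵛ-•ᶻ k y i = trans (cong ℤtoℚ (Vec.lookup∘tabulate (λ i → + k ℤ.* y i) i)) (ℤtoℚ-* (+ k) (y i))

ℤᵛ-injective : ∀ {n} {p q : Vec ℤ n} → (∀ i → ℤᵛ p i ≡ ℤᵛ q i) → p ≡ q
ℤᵛ-injective {p = p} {q} p≗q = trans (sym (Vec.tabulate∘lookup p))
  (trans (Vec.tabulate-cong (λ i → ℤtoℚ-injective (p≗q i))) (Vec.tabulate∘lookup q))

dot-ℚ : ∀ {n} (b : Fin n → ℕ) (p : Point n) → ℕtoℚ (dot b p) ≡ ℕᵛ b · ℕᵛ (lookup p)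
dot-ℚ b p = trans (ℕtoℚ-sumℕ (λ i → b i * lookup p i)) (sum-cong-≗ (λ i → ℕtoℚ-* (b i) (lookup p i)))

dot-•ᶻ-bezout : ∀ {n} (b : Fin n → ℕ) (y : Fin n → ℤ) k → sumℤ (λ i → + b i ℤ.* y i) ≡ + 1 →
                ℕᵛ b · ℤᵛ (k •ᶻ y) ≡ ℕtoℚ k
dot-•ᶻ-bezout b y k b·y≡1 = begin
  ℕᵛ b · ℤᵛ (k •ᶻ y)
    ≡⟨ sum-cong-≗ (λ i → trans (cong (ℕᵛ b i ℚ.*_) (ℤᵛ-•ᶻ k y i))
                               (solve 3 (λ B K Y → B :* (K :* Y) := K :* (B :* Y)) refl (ℕᵛ b i) (ℕtoℚ k) (ℤtoℚ (y i)))) ⟩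
  sum (λ i → ℕtoℚ k ℚ.* (ℕᵛ b i ℚ.* ℤtoℚ (y i)))
    ≡⟨ sym (*-distribˡ-sum (ℕtoℚ k) (λ i → ℕᵛ b i ℚ.* ℤtoℚ (y i))) ⟩
  ℕtoℚ k ℚ.* sum (λ i → ℕᵛ b i ℚ.* ℤtoℚ (y i))
    ≡⟨ cong (ℕtoℚ k ℚ.*_) (trans (sum-cong-≗ (λ i → sym (ℤtoℚ-* (+ b i) (y i))))
                                (trans (sym (ℤtoℚ-sumℤ (λ i → + b i ℤ.* y i))) (cong ℤtoℚ b·y≡1))) ⟩
  ℕtoℚ k ℚ.* 1ℚ
    ≡⟨ ℚ.*-identityʳ (ℕtoℚ k) ⟩
  ℕtoℚ k ∎
  where
  open ≡-Reasoning
  open +-*-Solver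

positive-dot≡0 : ∀ {n} {a : Fin n → ℕ} {x : Point n} → (∀ i → 1 ≤ a i) → dot a x ≡ 0 → ∀ i → lookup x i ≡ 0
positive-dot≡0 {a = a} {x} a-positive a·x≡0 i = ℕ.m*n≡0⇒m≡0 (lookup x i) (a i)
  (trans (ℕ.*-comm (lookup x i) (a i)) (sumℕ≡0⇒≡0 (λ i → a i * lookup x i) a·x≡0 i))
  where
  instance
    _ : ℕ.NonZero (a i)
    _ = ℕ.>-nonZero (a-positive i)

dot-origin : ∀ {n} (b : Fin n → ℕ) {x : Point n} → (∀ i → lookup x i ≡ 0) → dot b x ≡ 0
dot-origin b {x} x≡0 = sumℕ-zero (λ i → b i * lookup x i) (λ i → trans (cong (b i *_) (x≡0 i)) (ℕ.*-zeroʳ (b i)))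

record Parallelepiped {n} (v : Fin n → Point n) (X : Subset n) (m : ℕ) : Set where
  field
    base       : Fin n
    base∈X     : base ∈ X
    points     : List (Vec ℤ n)
    length≡    : List.length points ≡ m
    unique     : Unique points
    ∈⇒parPoint : ∀ {p} → p ∈L points → ParPoint v X base p
    parPoint⇒∈ : ∀ {p} → ParPoint v X base p → p ∈L points

parallelepiped : ∀ {n} {v : Fin n → Point n} {X m} → IsNV v X m → Parallelepiped v X m
parallelepiped (base , base∈X , points , length≡ , unique , membership) = record
  { base = base ; base∈X = base∈X ; points = points ; length≡ = length≡ ; unique = unique
  ; ∈⇒parPoint = λ {p} → proj₁ (membership p) ; parPoint⇒∈ = λ {p} → proj₂ (membership p) }

origin-parPoint : ∀ {n} (v : Fin n → Point n) X x₀ → ParPoint v X x₀ (Vec.replicate n (+ 0))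
origin-parPoint v X x₀ = (λ _ → 0ℚ) , (λ _ _ → refl) , (λ _ → ℚ.≤-refl , ℚ.*<* (ℤ.+<+ (s≤s z≤n))) ,
  (λ i → trans (cong ℤtoℚ (Vec.lookup-replicate i (+ 0)))
               (sym (trans (sumℚ≡sum (λ j → 0ℚ ℚ.* edge j i)) (sum-zero (λ j → ℚ.*-zeroˡ (edge j i))))))
  where
  edge : Fin _ → Fin _ → ℚ
  edge j i = ℕtoℚ (lookup (v j) i) ℚ.- ℕtoℚ (lookup (v x₀) i)

parallelepiped-1≤m : ∀ {n} {v : Fin n → Point n} {X m} → Parallelepiped v X m → 1 ≤ m
parallelepiped-1≤m {v = v} {X} P =
  subst (1 ≤_) length≡ (nonempty (parPoint⇒∈ {Vec.replicate _ (+ 0)} (origin-parPoint v X base)))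
  where
  open Parallelepiped P
  nonempty : ∀ {x} {xs : List (Vec ℤ _)} → x ∈L xs → 1 ≤ List.length xs
  nonempty (here _)  = s≤s z≤n
  nonempty (there _) = s≤s z≤n

record VFaceData {n} (v : Fin n → Point n) (J : Subset n) (N : ℕ) : Set where
  field
    I           : Subset n
    |I|≡|J|     : ∣ I ∣ ≡ ∣ J ∣
    v-outside   : ∀ j → j ∈ J → ∀ i → i ∉ I → lookup (v j) i ≡ 0
    b           : Fin n → ℕ
    b-positive  : ∀ i → i ∈ I → 1 ≤ b i
    b-primitive : PrimitiveOn I b
    b·v≡N       : ∀ j → j ∈ J → dot b (v j) ≡ N

vFaceData : ∀ {n} {v : Fin n → Point n} {J N} → IsN v J N → VFaceData v J N
vFaceData (I , (|I|≡|J| , v-outside) , b , b-positive , _ , b-primitive , b·v≡N) = record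
  { I = I ; |I|≡|J| = |I|≡|J| ; v-outside = v-outside ; b = b ; b-positive = b-positive
  ; b-primitive = b-primitive ; b·v≡N = b·v≡N }

module Simplex {n} (v : Fin n → Point n) (a : Fin n → ℕ) (Nτ : ℕ) (Nτ≢0 : Nτ ≢ 0)
               (a·v≡Nτ : ∀ j → dot a (v j) ≡ Nτ) (aff : AffIndep v) where

  vertex : Fin n → Fin n → ℚ
  vertex j = ℕᵛ (lookup (v j))

  a·vertex : ∀ j → ℕᵛ a · vertex j ≡ ℕtoℚ Nτ
  a·vertex j = trans (sym (dot-ℚ a (v j))) (cong ℕtoℚ (a·v≡Nτ j))

  HasCoords : (Fin n → ℚ) → (Fin n → ℚ) → Set
  HasCoords x c = ∀ i → x i ≡ lincomb c vertex i

  a·x≡Nτ*Σc : ∀ {x c} → HasCoords x c → ℕᵛ a · x ≡ ℕtoℚ Nτ ℚ.* sum c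
  a·x≡Nτ*Σc {x} {c} x≡ = begin
    ℕᵛ a · x                            ≡⟨ ·-congʳ (ℕᵛ a) x≡ ⟩
    ℕᵛ a · lincomb c vertex             ≡⟨ ·-lincomb (ℕᵛ a) c vertex ⟩
    sum (λ j → c j ℚ.* (ℕᵛ a · vertex j)) ≡⟨ sum-cong-≗ (λ j → cong (c j ℚ.*_) (a·vertex j)) ⟩
    sum (λ j → c j ℚ.* ℕtoℚ Nτ)          ≡⟨ sym (*-distribʳ-sum (ℕtoℚ Nτ) c) ⟩
    sum c ℚ.* ℕtoℚ Nτ                   ≡⟨ ℚ.*-comm (sum c) (ℕtoℚ Nτ) ⟩
    ℕtoℚ Nτ ℚ.* sum c                   ∎
    where open ≡-Reasoning

  -- The vertices lie on a hyperplane missing the origin, so affine independence gives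
  -- linear independence.
  vertices-independent : LinearlyIndependent vertex
  vertices-independent c lincomb≡0 =
    aff c (trans (sumℚ≡sum c) Σc≡0) (λ i → trans (sumℚ≡sum (λ j → c j ℚ.* vertex j i)) (lincomb≡0 i))
    where
    Σc≡0 : sum c ≡ 0ℚ
    Σc≡0 = x*y≡0⇒y≡0 (Nτ≢0 ∘ ℕtoℚ-injective)
      (trans (sym (a·x≡Nτ*Σc (λ i → refl)))
             (trans (·-congʳ (ℕᵛ a) lincomb≡0) (sum-zero (λ i → ℚ.*-zeroʳ (ℕᵛ a i)))))

  private
    coordinates : ∀ x → ∃[ c ] Supported ⊤ c × HasCoords x c
    coordinates x = spanned vertex ⊤ ⊤ vertices-independent ℕ.≤-refl (λ _ _ _ i∉⊤ → ⊥-elim (i∉⊤ ∈⊤))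
                            x (λ _ i∉⊤ → ⊥-elim (i∉⊤ ∈⊤))

  -- Opaque, like the other witnesses below: unfolding the elimination term stalls type checking.
  opaque
    coords : (Fin n → ℚ) → Fin n → ℚ
    coords x = proj₁ (coordinates x)

    coords-spec : ∀ x → HasCoords x (coords x)
    coords-spec x = proj₂ (proj₂ (coordinates x))

  coords-unique : ∀ {x c} → HasCoords x c → ∀ j → coords x j ≡ c j
  coords-unique {x} {c} x≡ j = p-q≡0⇒p≡q _ _ (vertices-independent (λ j → coords x j ℚ.- c j) difference≡0 j)
    where
    difference≡0 : ∀ i → lincomb (λ j → coords x j ℚ.- c j) vertex i ≡ 0ℚ
    difference≡0 i = trans (lincomb-- (coords x) c vertex i)
      (trans (cong₂ ℚ._-_ (sym (coords-spec x i)) (sym (x≡ i))) (ℚ.+-inverseʳ (x i)))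

  coordsᶻ : Vec ℤ n → Fin n → ℚ
  coordsᶻ p = coords (ℤᵛ p)

  coordsᶻ-+ : ∀ p q j → coordsᶻ (p +ᶻ q) j ≡ coordsᶻ p j ℚ.+ coordsᶻ q j
  coordsᶻ-+ p q = coords-unique (λ i → begin
    ℤᵛ (p +ᶻ q) i
      ≡⟨ ℤᵛ-+ p q i ⟩
    ℤᵛ p i ℚ.+ ℤᵛ q i
      ≡⟨ cong₂ ℚ._+_ (coords-spec (ℤᵛ p) i) (coords-spec (ℤᵛ q) i) ⟩
    lincomb (coordsᶻ p) vertex i ℚ.+ lincomb (coordsᶻ q) vertex i
      ≡⟨ sym (lincomb-+ (coordsᶻ p) (coordsᶻ q) vertex i) ⟩
    lincomb (λ j → coordsᶻ p j ℚ.+ coordsᶻ q j) vertex i ∎)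
    where open ≡-Reasoning

  coordsᶻ-- : ∀ p q j → coordsᶻ (p -ᶻ q) j ≡ coordsᶻ p j ℚ.- coordsᶻ q j
  coordsᶻ-- p q = coords-unique (λ i → begin
    ℤᵛ (p -ᶻ q) i
      ≡⟨ ℤᵛ-- p q i ⟩
    ℤᵛ p i ℚ.- ℤᵛ q i
      ≡⟨ cong₂ ℚ._-_ (coords-spec (ℤᵛ p) i) (coords-spec (ℤᵛ q) i) ⟩
    lincomb (coordsᶻ p) vertex i ℚ.- lincomb (coordsᶻ q) vertex i
      ≡⟨ sym (lincomb-- (coordsᶻ p) (coordsᶻ q) vertex i) ⟩
    lincomb (λ j → coordsᶻ p j ℚ.- coordsᶻ q j) vertex i ∎)
    where open ≡-Reasoning

  edge : Fin n → Fin n → Fin n → ℚ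
  edge x₀ j i = vertex j i ℚ.- vertex x₀ i

  -- ParPoint describes a point as Σ_j l j • edge x₀ j; these are its coordinates.
  fromEdges : Fin n → (Fin n → ℚ) → Fin n → ℚ
  fromEdges x₀ l j = l j ℚ.- δ x₀ j ℚ.* sum l

  edges-hasCoords : ∀ x₀ l → HasCoords (λ i → sum (λ j → l j ℚ.* edge x₀ j i)) (fromEdges x₀ l)
  edges-hasCoords x₀ l i = begin
    sum (λ j → l j ℚ.* (vertex j i ℚ.- vertex x₀ i))
      ≡⟨ sum-cong-≗ (λ j → solve 3 (λ l u w → l :* (u :- w) := l :* u :- l :* w) refl (l j) (vertex j i) (vertex x₀ i)) ⟩
    sum (λ j → l j ℚ.* vertex j i ℚ.- l j ℚ.* vertex x₀ i)
      ≡⟨ sum-- (λ j → l j ℚ.* vertex j i) (λ j → l j ℚ.* vertex x₀ i) ⟩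
    lincomb l vertex i ℚ.- sum (λ j → l j ℚ.* vertex x₀ i)
      ≡⟨ cong (ℚ._-_ (lincomb l vertex i)) (sym (*-distribʳ-sum (vertex x₀ i) l)) ⟩
    lincomb l vertex i ℚ.- sum l ℚ.* vertex x₀ i
      ≡⟨ cong (ℚ._-_ (lincomb l vertex i)) (sym (sum-δ* x₀ (λ j → sum l ℚ.* vertex j i))) ⟩
    lincomb l vertex i ℚ.- sum (λ j → δ x₀ j ℚ.* (sum l ℚ.* vertex j i))
      ≡⟨ cong (ℚ._-_ (lincomb l vertex i)) (sum-cong-≗ (λ j → sym (ℚ.*-assoc (δ x₀ j) (sum l) (vertex j i)))) ⟩
    lincomb l vertex i ℚ.- lincomb (λ j → δ x₀ j ℚ.* sum l) vertex i
      ≡⟨ sym (lincomb-- l (λ j → δ x₀ j ℚ.* sum l) vertex i) ⟩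
    lincomb (fromEdges x₀ l) vertex i ∎
    where
    open ≡-Reasoning
    open +-*-Solver

  sum-fromEdges : ∀ x₀ l → sum (fromEdges x₀ l) ≡ 0ℚ
  sum-fromEdges x₀ l = begin
    sum (λ j → l j ℚ.- δ x₀ j ℚ.* sum l)     ≡⟨ sum-- l (λ j → δ x₀ j ℚ.* sum l) ⟩
    sum l ℚ.- sum (λ j → δ x₀ j ℚ.* sum l)   ≡⟨ cong (ℚ._-_ (sum l)) (sum-δ* x₀ (λ _ → sum l)) ⟩
    sum l ℚ.- sum l                          ≡⟨ ℚ.+-inverseʳ (sum l) ⟩
    0ℚ                                       ∎
    where open ≡-Reasoning

  fromEdges-≢ : ∀ x₀ l {j} → j ≢ x₀ → fromEdges x₀ l j ≡ l j
  fromEdges-≢ x₀ l {j} j≢x₀ = trans (cong (λ d → l j ℚ.- d ℚ.* sum l) (δ-offdiag x₀ j j≢x₀))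
                                    (trans (cong (ℚ._-_ (l j)) (ℚ.*-zeroˡ (sum l))) (ℚ.+-identityʳ (l j)))

  fromEdges-Σ≡0 : ∀ x₀ l → sum l ≡ 0ℚ → ∀ j → fromEdges x₀ l j ≡ l j
  fromEdges-Σ≡0 x₀ l Σl≡0 j = trans (cong (λ s → l j ℚ.- δ x₀ j ℚ.* s) Σl≡0)
                                    (trans (cong (ℚ._-_ (l j)) (ℚ.*-zeroʳ (δ x₀ j))) (ℚ.+-identityʳ (l j)))

  direction-edges : ∀ x₀ x → sum (coordsᶻ x) ≡ 0ℚ → ∀ i → sum (λ j → coordsᶻ x j ℚ.* edge x₀ j i) ≡ ℤᵛ x i
  direction-edges x₀ x Σc≡0 i = begin
    sum (λ j → coordsᶻ x j ℚ.* edge x₀ j i)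
      ≡⟨ edges-hasCoords x₀ (coordsᶻ x) i ⟩
    lincomb (fromEdges x₀ (coordsᶻ x)) vertex i
      ≡⟨ sum-cong-≗ (λ j → cong (ℚ._* vertex j i) (fromEdges-Σ≡0 x₀ (coordsᶻ x) Σc≡0 j)) ⟩
    lincomb (coordsᶻ x) vertex i
      ≡⟨ sym (coords-spec (ℤᵛ x) i) ⟩
    ℤᵛ x i ∎
    where open ≡-Reasoning

  module _ {X x₀ p} (pp : ParPoint v X x₀ p) where
    private
      l = proj₁ pp

    parPoint-coords : ∀ j → coordsᶻ p j ≡ fromEdges x₀ l j
    parPoint-coords = coords-unique (λ i → trans (proj₂ (proj₂ (proj₂ pp)) i)
      (trans (sumℚ≡sum (λ j → l j ℚ.* edge x₀ j i)) (edges-hasCoords x₀ l i)))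

    parPoint-Σcoords : sum (coordsᶻ p) ≡ 0ℚ
    parPoint-Σcoords = trans (sum-cong-≗ parPoint-coords) (sum-fromEdges x₀ l)

    parPoint-coords-outside : x₀ ∈ X → ∀ j → j ∉ X → coordsᶻ p j ≡ 0ℚ
    parPoint-coords-outside x₀∈X j j∉X =
      trans (parPoint-coords j) (trans (fromEdges-≢ x₀ l j≢x₀) (proj₁ (proj₂ pp) j (inj₁ j∉X)))
      where
      j≢x₀ : j ≢ x₀
      j≢x₀ refl = j∉X x₀∈X

  parPoint-unique : ∀ {X x₀ p q} → ParPoint v X x₀ p → ParPoint v X x₀ q →
                    (∀ j → Integral (coordsᶻ p j ℚ.- coordsᶻ q j)) → p ≡ q
  parPoint-unique {X} {x₀} {p} {q} pp@(l , l-zero , l-bounds , p≡) qq@(l′ , l′-zero , l′-bounds , q≡) integral =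
    ℤᵛ-injective (λ i → begin
      ℤᵛ p i                          ≡⟨ trans (p≡ i) (sumℚ≡sum (λ j → l j ℚ.* edge x₀ j i)) ⟩
      sum (λ j → l j ℚ.* edge x₀ j i)  ≡⟨ sum-cong-≗ (λ j → cong (ℚ._* edge x₀ j i) (l≡l′ j)) ⟩
      sum (λ j → l′ j ℚ.* edge x₀ j i) ≡⟨ sym (trans (q≡ i) (sumℚ≡sum (λ j → l′ j ℚ.* edge x₀ j i))) ⟩
      ℤᵛ q i                          ∎)
    where
    open ≡-Reasoning
    l≡l′ : ∀ j → l j ≡ l′ j
    l≡l′ j with j Fin.≟ x₀
    ... | yes refl = trans (l-zero j (inj₂ refl)) (sym (l′-zero j (inj₂ refl)))
    ... | no  j≢x₀ = halfOpenUnit-integral-diff⇒≡ (l-bounds j) (l′-bounds j)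
      (subst Integral (cong₂ ℚ._-_ (trans (parPoint-coords {X} {x₀} {p} pp j) (fromEdges-≢ x₀ l j≢x₀))
                                   (trans (parPoint-coords {X} {x₀} {q} qq j) (fromEdges-≢ x₀ l′ j≢x₀)))
                      (integral j))

  ⌊coords⌋ : Vec ℤ n → Fin n → ℚ
  ⌊coords⌋ x j = ℤtoℚ (ℚ.floor (coordsᶻ x j))

  latticeShift : Fin n → Vec ℤ n → Fin n → ℤ
  latticeShift x₀ x i = sumℤ (λ j → ℚ.floor (coordsᶻ x j) ℤ.* (+ lookup (v j) i ℤ.- + lookup (v x₀) i))

  reduce : Fin n → Vec ℤ n → Vec ℤ n
  reduce x₀ x = tabulate (λ i → lookup x i ℤ.- latticeShift x₀ x i)

  ℤᵛ-reduce : ∀ x₀ x i → ℤᵛ (reduce x₀ x) i ≡ ℤᵛ x i ℚ.- sum (λ j → ⌊coords⌋ x j ℚ.* edge x₀ j i)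
  ℤᵛ-reduce x₀ x i = begin
    ℤtoℚ (lookup (reduce x₀ x) i)
      ≡⟨ cong ℤtoℚ (Vec.lookup∘tabulate _ i) ⟩
    ℤtoℚ (lookup x i ℤ.- latticeShift x₀ x i)
      ≡⟨ ℤtoℚ-- (lookup x i) (latticeShift x₀ x i) ⟩
    ℤᵛ x i ℚ.- ℤtoℚ (latticeShift x₀ x i)
      ≡⟨ cong (ℚ._-_ (ℤᵛ x i)) (trans (ℤtoℚ-sumℤ (λ j → ⌊c⌋ j ℤ.* edgeℤ j)) (sum-cong-≗ (λ j →
           trans (ℤtoℚ-* (⌊c⌋ j) (edgeℤ j))
                 (cong (⌊coords⌋ x j ℚ.*_) (ℤtoℚ-- (+ lookup (v j) i) (+ lookup (v x₀) i)))))) ⟩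
    ℤᵛ x i ℚ.- sum (λ j → ⌊coords⌋ x j ℚ.* edge x₀ j i) ∎
    where
    open ≡-Reasoning
    ⌊c⌋ : Fin n → ℤ
    ⌊c⌋ j = ℚ.floor (coordsᶻ x j)
    edgeℤ : Fin n → ℤ
    edgeℤ j = + lookup (v j) i ℤ.- + lookup (v x₀) i

  reduce-coords : ∀ x₀ x j → coordsᶻ (reduce x₀ x) j ≡ coordsᶻ x j ℚ.- fromEdges x₀ (⌊coords⌋ x) j
  reduce-coords x₀ x = coords-unique (λ i → begin
    ℤᵛ (reduce x₀ x) i
      ≡⟨ ℤᵛ-reduce x₀ x i ⟩
    ℤᵛ x i ℚ.- sum (λ j → ⌊coords⌋ x j ℚ.* edge x₀ j i)
      ≡⟨ cong₂ ℚ._-_ (coords-spec (ℤᵛ x) i) (edges-hasCoords x₀ (⌊coords⌋ x) i) ⟩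
    lincomb (coordsᶻ x) vertex i ℚ.- lincomb (fromEdges x₀ (⌊coords⌋ x)) vertex i
      ≡⟨ sym (lincomb-- (coordsᶻ x) (fromEdges x₀ (⌊coords⌋ x)) vertex i) ⟩
    lincomb (λ j → coordsᶻ x j ℚ.- fromEdges x₀ (⌊coords⌋ x) j) vertex i ∎)
    where open ≡-Reasoning

  reduce-congruent : ∀ x₀ x j → Integral (coordsᶻ x j ℚ.- coordsᶻ (reduce x₀ x) j)
  reduce-congruent x₀ x j = subst Integral shift≡
    (integral-- (integral-⌊coords⌋ j) (integral-* (integral-δ x₀ j) (integral-sum integral-⌊coords⌋)))
    where
    integral-⌊coords⌋ : ∀ k → Integral (⌊coords⌋ x k)
    integral-⌊coords⌋ k = integral-ℤtoℚ (ℚ.floor (coordsᶻ x k))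
    shift≡ : fromEdges x₀ (⌊coords⌋ x) j ≡ coordsᶻ x j ℚ.- coordsᶻ (reduce x₀ x) j
    shift≡ = trans (solve 2 (λ c f → f := c :- (c :- f)) refl (coordsᶻ x j) (fromEdges x₀ (⌊coords⌋ x) j))
                   (cong (ℚ._-_ (coordsᶻ x j)) (sym (reduce-coords x₀ x j)))
      where open +-*-Solver

  reduce-cong : ∀ x₀ x y → reduce x₀ x ≡ reduce x₀ y → ∀ j → Integral (coordsᶻ x j ℚ.- coordsᶻ y j)
  reduce-cong x₀ x y rx≡ry j = subst Integral
    (solve 3 (λ X Y R → (X :- R) :- (Y :- R) := X :- Y) refl (coordsᶻ x j) (coordsᶻ y j) (coordsᶻ (reduce x₀ y) j))
    (integral-- (subst (λ r → Integral (coordsᶻ x j ℚ.- coordsᶻ r j)) rx≡ry (reduce-congruent x₀ x j))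
                (reduce-congruent x₀ y j))
    where open +-*-Solver

  fracCoords : Fin n → Vec ℤ n → Fin n → ℚ
  fracCoords x₀ x j with j Fin.≟ x₀
  ... | yes _ = 0ℚ
  ... | no  _ = frac (coordsᶻ x j)

  fracCoords-vanishing : ∀ X x₀ x → (∀ j → j ∉ X → Integral (coordsᶻ x j)) →
                         ∀ j → (j ∉ X ⊎ j ≡ x₀) → fracCoords x₀ x j ≡ 0ℚ
  fracCoords-vanishing X x₀ x integral-outside j j∉X∨j≡x₀ with j Fin.≟ x₀ | j∉X∨j≡x₀
  ... | yes _    | _         = refl
  ... | no  _    | inj₁ j∉X  = frac-integral (integral-outside j j∉X)
  ... | no  j≢x₀ | inj₂ j≡x₀ = ⊥-elim (j≢x₀ j≡x₀)

  fracCoords-halfOpenUnit : ∀ x₀ x j → HalfOpenUnit (fracCoords x₀ x j)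
  fracCoords-halfOpenUnit x₀ x j with j Fin.≟ x₀
  ... | yes _ = ℚ.≤-refl , ℚ.*<* (ℤ.+<+ (s≤s z≤n))
  ... | no  _ = frac-halfOpenUnit (coordsᶻ x j)

  fracCoords*edge : ∀ x₀ x i j → fracCoords x₀ x j ℚ.* edge x₀ j i ≡ frac (coordsᶻ x j) ℚ.* edge x₀ j i
  fracCoords*edge x₀ x i j with j Fin.≟ x₀
  ... | yes refl = trans (ℚ.*-zeroˡ (edge j j i))
                         (sym (trans (cong (frac (coordsᶻ x j) ℚ.*_) (ℚ.+-inverseʳ (vertex j i)))
                                     (ℚ.*-zeroʳ (frac (coordsᶻ x j)))))
  ... | no  _    = refl

  reduce-fracCoords : ∀ x₀ x → sum (coordsᶻ x) ≡ 0ℚ →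
                      ∀ i → ℤᵛ (reduce x₀ x) i ≡ sumℚ (λ j → fracCoords x₀ x j ℚ.* edge x₀ j i)
  reduce-fracCoords x₀ x Σc≡0 i = sym (begin
    sumℚ (λ j → fracCoords x₀ x j ℚ.* edge x₀ j i)
      ≡⟨ trans (sumℚ≡sum (λ j → fracCoords x₀ x j ℚ.* edge x₀ j i)) (sum-cong-≗ (fracCoords*edge x₀ x i)) ⟩
    sum (λ j → (c j ℚ.- ⌊coords⌋ x j) ℚ.* edge x₀ j i)
      ≡⟨ sum-cong-≗ (λ j → solve 3 (λ c f e → (c :- f) :* e := c :* e :- f :* e)
                                   refl (c j) (⌊coords⌋ x j) (edge x₀ j i)) ⟩
    sum (λ j → c j ℚ.* edge x₀ j i ℚ.- ⌊coords⌋ x j ℚ.* edge x₀ j i)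
      ≡⟨ sum-- (λ j → c j ℚ.* edge x₀ j i) (λ j → ⌊coords⌋ x j ℚ.* edge x₀ j i) ⟩
    sum (λ j → c j ℚ.* edge x₀ j i) ℚ.- sum (λ j → ⌊coords⌋ x j ℚ.* edge x₀ j i)
      ≡⟨ cong (ℚ._- sum (λ j → ⌊coords⌋ x j ℚ.* edge x₀ j i)) (direction-edges x₀ x Σc≡0 i) ⟩
    ℤᵛ x i ℚ.- sum (λ j → ⌊coords⌋ x j ℚ.* edge x₀ j i)
      ≡⟨ sym (ℤᵛ-reduce x₀ x i) ⟩
    ℤᵛ (reduce x₀ x) i ∎)
    where
    open ≡-Reasoning
    open +-*-Solver
    c = coordsᶻ x

  reduce-parPoint : ∀ X x₀ x → sum (coordsᶻ x) ≡ 0ℚ → (∀ j → j ∉ X → Integral (coordsᶻ x j)) →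
                    ParPoint v X x₀ (reduce x₀ x)
  reduce-parPoint X x₀ x Σc≡0 integral-outside =
    fracCoords x₀ x , fracCoords-vanishing X x₀ x integral-outside , fracCoords-halfOpenUnit x₀ x ,
    reduce-fracCoords x₀ x Σc≡0

  module Points {X m} (P : Parallelepiped v X m) where
    open Parallelepiped P public

    Σcoords≡0 : ∀ {p} → p ∈L points → sum (coordsᶻ p) ≡ 0ℚ
    Σcoords≡0 {p} p∈ = parPoint-Σcoords {X} {base} {p} (∈⇒parPoint p∈)

    coords-outside : ∀ {p} → p ∈L points → ∀ j → j ∉ X → coordsᶻ p j ≡ 0ℚ
    coords-outside {p} p∈ = parPoint-coords-outside {X} {base} {p} (∈⇒parPoint p∈) base∈X

    congruent⇒≡ : ∀ {p q} → p ∈L points → q ∈L points →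
                  (∀ j → Integral (coordsᶻ p j ℚ.- coordsᶻ q j)) → p ≡ q
    congruent⇒≡ p∈ q∈ = parPoint-unique (∈⇒parPoint p∈) (∈⇒parPoint q∈)

    reduce∈ : ∀ x → sum (coordsᶻ x) ≡ 0ℚ → (∀ j → j ∉ X → Integral (coordsᶻ x j)) →
              reduce base x ∈L points
    reduce∈ x Σ≡0 integral-outside = parPoint⇒∈ (reduce-parPoint X base x Σ≡0 integral-outside)

    origin∈ : Vec.replicate n (+ 0) ∈L points
    origin∈ = parPoint⇒∈ {Vec.replicate n (+ 0)} (origin-parPoint v X base)

  module Face {J : Subset n} {N : ℕ} (isN : IsN v J N) (J≢∅ : Nonempty J) where
    open VFaceData (vFaceData {v = v} isN) public

    vertex-supported : ∀ j → j ∈ J → Supported I (vertex j)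
    vertex-supported j j∈J i i∉I = cong ℕtoℚ (v-outside j j∈J i i∉I)

    opaque
      spanned-by-face : ∀ x → Supported I x → ∃[ c ] Supported J c × HasCoords x c
      spanned-by-face = spanned vertex J I vertices-independent (ℕ.≤-reflexive |I|≡|J|) vertex-supported

    coords-outside : ∀ x → Supported I x → ∀ j → j ∉ J → coords x j ≡ 0ℚ
    coords-outside x x-supp j j∉J with spanned-by-face x x-supp
    ... | c , c-supp , x≡ = trans (coords-unique {c = c} x≡ j) (c-supp j j∉J)

    b·x≡N*Σc : ∀ {x c} → HasCoords x c → Supported J c → ℕᵛ b · x ≡ ℕtoℚ N ℚ.* sum c
    b·x≡N*Σc {x} {c} x≡ c-supp = begin
      ℕᵛ b · x                              ≡⟨ ·-congʳ (ℕᵛ b) x≡ ⟩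
      ℕᵛ b · lincomb c vertex               ≡⟨ ·-lincomb (ℕᵛ b) c vertex ⟩
      sum (λ j → c j ℚ.* (ℕᵛ b · vertex j)) ≡⟨ sum-cong-≗ termwise ⟩
      sum (λ j → c j ℚ.* ℕtoℚ N)             ≡⟨ sym (*-distribʳ-sum (ℕtoℚ N) c) ⟩
      sum c ℚ.* ℕtoℚ N                      ≡⟨ ℚ.*-comm (sum c) (ℕtoℚ N) ⟩
      ℕtoℚ N ℚ.* sum c                      ∎
      where
      open ≡-Reasoning
      termwise : ∀ j → c j ℚ.* (ℕᵛ b · vertex j) ≡ c j ℚ.* ℕtoℚ N
      termwise j with j ∈? J
      ... | yes j∈J = cong (c j ℚ.*_) (trans (sym (dot-ℚ b (v j))) (cong ℕtoℚ (b·v≡N j j∈J)))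
      ... | no  j∉J = trans (cong (ℚ._* (ℕᵛ b · vertex j)) (c-supp j j∉J))
                            (trans (ℚ.*-zeroˡ (ℕᵛ b · vertex j))
                                   (sym (trans (cong (ℚ._* ℕtoℚ N) (c-supp j j∉J)) (ℚ.*-zeroˡ (ℕtoℚ N)))))

    -- Evaluate a and b on the unit vector e i ∈ span{v j : j ∈ J}.
    a*N≡b*Nτ : ∀ i → i ∈ I → a i * N ≡ b i * Nτ
    a*N≡b*Nτ i i∈I with spanned-by-face (δ i) (λ k k∉I → δ-offdiag i k (λ { refl → k∉I i∈I }))
    ... | c , c-supp , eᵢ≡ = ℕtoℚ-injective (begin
      ℕtoℚ (a i * N)
        ≡⟨ ℕtoℚ-* (a i) N ⟩
      ℕtoℚ (a i) ℚ.* ℕtoℚ N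
        ≡⟨ cong (ℚ._* ℕtoℚ N) (trans (sym (·-δ (ℕᵛ a) i)) (a·x≡Nτ*Σc {c = c} eᵢ≡)) ⟩
      ℕtoℚ Nτ ℚ.* sum c ℚ.* ℕtoℚ N
        ≡⟨ solve 3 (λ T S M → T :* S :* M := M :* S :* T) refl (ℕtoℚ Nτ) (sum c) (ℕtoℚ N) ⟩
      ℕtoℚ N ℚ.* sum c ℚ.* ℕtoℚ Nτ
        ≡⟨ cong (ℚ._* ℕtoℚ Nτ) (sym (trans (sym (·-δ (ℕᵛ b) i)) (b·x≡N*Σc eᵢ≡ c-supp))) ⟩
      ℕtoℚ (b i) ℚ.* ℕtoℚ Nτ
        ≡⟨ sym (ℕtoℚ-* (b i) Nτ) ⟩
      ℕtoℚ (b i * Nτ) ∎)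
      where
      open ≡-Reasoning
      open +-*-Solver

    I≢∅ : Nonempty I
    I≢∅ = 0<∣p∣⇒nonempty I (subst (0 <_) (sym |I|≡|J|) 0<∣J∣)
      where
      0<∣J∣ : 0 < ∣ J ∣
      0<∣J∣ = subst (0 <_) (sym (∣p∣≡1+∣p-x∣ (proj₂ J≢∅))) (s≤s z≤n)

    N≢0 : N ≢ 0
    N≢0 N≡0 = Nτ≢0 (ℕ.m*n≡0⇒m≡0 Nτ (b i₀) (trans (ℕ.*-comm Nτ (b i₀))
      (trans (sym (a*N≡b*Nτ i₀ i₀∈I)) (trans (cong (a i₀ *_) N≡0) (ℕ.*-zeroʳ (a i₀))))))
      where
      i₀ = proj₁ I≢∅
      i₀∈I = proj₂ I≢∅
      instance
        _ : ℕ.NonZero (b i₀)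
        _ = ℕ.>-nonZero (b-positive i₀ i₀∈I)

    private opaque
      scale : ∃[ s ] Nτ ≡ s * N × (∀ i → i ∈ I → a i ≡ s * b i)
      scale = proportional-on b-primitive N≢0 a*N≡b*Nτ

    s : ℕ
    s = proj₁ scale

    Nτ≡s*N : Nτ ≡ s * N
    Nτ≡s*N = proj₁ (proj₂ scale)

    a≡s*b : ∀ i → i ∈ I → a i ≡ s * b i
    a≡s*b = proj₂ (proj₂ scale)

    a·u≡s*b·u : ∀ u → Supported I u → ℕᵛ a · u ≡ ℕtoℚ s ℚ.* (ℕᵛ b · u)
    a·u≡s*b·u u u-supp = trans (sum-cong-≗ termwise) (sym (*-distribˡ-sum (ℕtoℚ s) (λ i → ℕᵛ b i ℚ.* u i)))
      where
      termwise : ∀ i → ℕᵛ a i ℚ.* u i ≡ ℕtoℚ s ℚ.* (ℕᵛ b i ℚ.* u i)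
      termwise i with i ∈? I
      ... | yes i∈I = trans (cong (ℚ._* u i) (trans (cong ℕtoℚ (a≡s*b i i∈I)) (ℕtoℚ-* s (b i))))
                            (ℚ.*-assoc (ℕtoℚ s) (ℕᵛ b i) (u i))
      ... | no  i∉I rewrite u-supp i i∉I =
        trans (ℚ.*-zeroʳ (ℕᵛ a i)) (sym (trans (cong (ℕtoℚ s ℚ.*_) (ℚ.*-zeroʳ (ℕᵛ b i))) (ℚ.*-zeroʳ (ℕtoℚ s))))

    s∣ℚa·u : ∀ u → (∀ i → Integral (u i)) → Supported I u → s ∣ℚ ℕᵛ a · u
    s∣ℚa·u u u-integral u-supp = subst (s ∣ℚ_) (sym (a·u≡s*b·u u u-supp))
      (∣ℚ-* {s} (integral-sum (λ i → integral-* (integral-ℤtoℚ (+ b i)) (u-integral i))))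

    contributes⇒s∣ν : ∀ {m} → Contributes Nτ (ν a) N m → s ∣ ν a
    contributes⇒s∣ν (_ , Nτ∣ν*N) = *-cancelʳ-∣ N (subst (_∣ ν a * N) Nτ≡s*N Nτ∣ν*N)
      where
      instance
        _ : ℕ.NonZero N
        _ = ℕ.≢-nonZero N≢0

    s∣ν⇒contributes : ∀ {m} → 1 ≤ m → s ∣ ν a → Contributes Nτ (ν a) N m
    s∣ν⇒contributes 1≤m s∣ν = 1≤m , subst (_∣ ν a * N) (sym Nτ≡s*N) (*-monoˡ-∣ N s∣ν)

    -- A multiple of a Bézout vector for b.
    opaque
      latticePoint : s ∣ ν a → ∃[ y ] Supported I (ℤᵛ y) × ℕᵛ a · ℤᵛ y ≡ ℕtoℚ (ν a)
      latticePoint (divides k ν≡k*s) = k •ᶻ y₀ , y-supp , (begin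
        ℕᵛ a · ℤᵛ (k •ᶻ y₀)              ≡⟨ a·u≡s*b·u (ℤᵛ (k •ᶻ y₀)) y-supp ⟩
        ℕtoℚ s ℚ.* (ℕᵛ b · ℤᵛ (k •ᶻ y₀)) ≡⟨ cong (ℕtoℚ s ℚ.*_) (dot-•ᶻ-bezout b y₀ k b·y₀≡1) ⟩
        ℕtoℚ s ℚ.* ℕtoℚ k                ≡⟨ sym (trans (cong ℕtoℚ (trans ν≡k*s (ℕ.*-comm k s))) (ℕtoℚ-* s k)) ⟩
        ℕtoℚ (ν a)                       ∎)
        where
        open ≡-Reasoning
        y₀ : Fin n → ℤ
        y₀ = proj₁ (primitiveOn⇒bezout b-primitive)
        y₀-supp : ∀ i → i ∉ I → y₀ i ≡ + 0
        y₀-supp = proj₁ (proj₂ (primitiveOn⇒bezout b-primitive))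
        b·y₀≡1 : sumℤ (λ i → + b i ℤ.* y₀ i) ≡ + 1
        b·y₀≡1 = proj₂ (proj₂ (primitiveOn⇒bezout b-primitive))
        y-supp : Supported I (ℤᵛ (k •ᶻ y₀))
        y-supp i i∉I = trans (ℤᵛ-•ᶻ k y₀ i)
          (trans (cong (λ z → ℕtoℚ k ℚ.* ℤtoℚ z) (y₀-supp i i∉I)) (ℚ.*-zeroʳ (ℕtoℚ k)))

  module Counting {J J′ : Subset n} {N N′ N″ mτ m m′ m″ : ℕ}
                  (J≢∅ : Nonempty J) (J′≢∅ : Nonempty J′) (K≢∅ : Nonempty (J ∩ J′))
                  (nvτ : IsNV v ⊤ mτ)
                  (isN : IsN v J N) (nv : IsNV v J m)
                  (isN′ : IsN v J′ N′) (nv′ : IsNV v J′ m′)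
                  (isN″ : IsN v (J ∩ J′) N″) (nv″ : IsNV v (J ∩ J′) m″)
                  (contrib : Contributes Nτ (ν a) N m) (contrib′ : Contributes Nτ (ν a) N′ m′)
                  (¬contrib″ : ¬ Contributes Nτ (ν a) N″ m″) where


    private
      module σ  = Face isN J≢∅
      module σ′ = Face isN′ J′≢∅
      module κ  = Face isN″ K≢∅
      module Pτ  = Points (parallelepiped nvτ)
      module Pσ  = Points (parallelepiped nv)
      module Pσ′ = Points (parallelepiped nv′)
      module Pκ  = Points (parallelepiped nv″)

    Pair : Set
    Pair = Vec ℤ n × Vec ℤ n

    pairs : List Pair
    pairs = List.cartesianProduct Pσ.points Pσ′.points

    targets : List Pair
    targets = List.cartesianProduct Pτ.points Pκ.points

    _≟ᶻ_ : DecidableEquality (Vec ℤ n)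
    _≟ᶻ_ = Vec.≡-dec ℤ._≟_

    sumClass : Pair → Vec ℤ n
    sumClass (p , q) = reduce Pτ.base (p +ᶻ q)

    sumClass-congruent : ∀ p q p′ q′ → sumClass (p , q) ≡ sumClass (p′ , q′) →
                         ∀ j → Integral ((coordsᶻ p j ℚ.+ coordsᶻ q j) ℚ.- (coordsᶻ p′ j ℚ.+ coordsᶻ q′ j))
    sumClass-congruent p q p′ q′ eq j =
      subst Integral (cong₂ ℚ._-_ (coordsᶻ-+ p q j) (coordsᶻ-+ p′ q′ j)) (reduce-cong Pτ.base (p +ᶻ q) (p′ +ᶻ q′) eq j)

    sumClass∈ : ∀ {p q} → p ∈L Pσ.points → q ∈L Pσ′.points → sumClass (p , q) ∈L Pτ.points
    sumClass∈ {p} {q} p∈ q∈ = Pτ.reduce∈ (p +ᶻ q) Σ≡0 (λ j j∉⊤ → ⊥-elim (j∉⊤ ∈⊤))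
      where
      Σ≡0 : sum (coordsᶻ (p +ᶻ q)) ≡ 0ℚ
      Σ≡0 = trans (sum-cong-≗ (coordsᶻ-+ p q))
                  (trans (∑-distrib-+ (coordsᶻ p) (coordsᶻ q)) (cong₂ ℚ._+_ (Pσ.Σcoords≡0 p∈) (Pσ′.Σcoords≡0 q∈)))

    pivot : Pair → Vec ℤ n
    pivot x = proj₁ (representative _≟ᶻ_ sumClass pairs x)

    G : Pair → Pair
    G x = sumClass x , reduce Pκ.base (proj₁ x -ᶻ pivot x)

    module _ {p q} (p∈ : p ∈L Pσ.points) (q∈ : q ∈L Pσ′.points) where
      private
        x∈ : (p , q) ∈L pairs
        x∈ = ∈-cartesianProduct⁺ p∈ q∈
        rep-spec = representative-spec _≟ᶻ_ sumClass pairs x∈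
        p₀ = pivot (p , q)
        q₀ = proj₂ (representative _≟ᶻ_ sumClass pairs (p , q))
        p₀∈ : p₀ ∈L Pσ.points
        p₀∈ = proj₁ (∈-cartesianProduct⁻ Pσ.points Pσ′.points (proj₁ rep-spec))
        q₀∈ : q₀ ∈L Pσ′.points
        q₀∈ = proj₂ (∈-cartesianProduct⁻ Pσ.points Pσ′.points (proj₁ rep-spec))

      -- p + q ≡ p₀ + q₀ modulo the edges of τ, and q, q₀ have no coordinates outside J′.
      pivot-difference-integral : ∀ j → j ∉ J ∩ J′ → Integral (coordsᶻ (p -ᶻ p₀) j)
      pivot-difference-integral j j∉K with j ∈? J
      ... | no  j∉J = + 0 , trans (coordsᶻ-- p p₀ j)
                               (cong₂ ℚ._-_ (Pσ.coords-outside p∈ j j∉J) (Pσ.coords-outside p₀∈ j j∉J))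
      ... | yes j∈J = subst Integral (begin
        (coordsᶻ p j ℚ.+ coordsᶻ q j) ℚ.- (coordsᶻ p₀ j ℚ.+ coordsᶻ q₀ j)
          ≡⟨ cong₂ (λ s t → (coordsᶻ p j ℚ.+ s) ℚ.- (coordsᶻ p₀ j ℚ.+ t))
                   (Pσ′.coords-outside q∈ j j∉J′) (Pσ′.coords-outside q₀∈ j j∉J′) ⟩
        (coordsᶻ p j ℚ.+ 0ℚ) ℚ.- (coordsᶻ p₀ j ℚ.+ 0ℚ)
          ≡⟨ cong₂ ℚ._-_ (ℚ.+-identityʳ (coordsᶻ p j)) (ℚ.+-identityʳ (coordsᶻ p₀ j)) ⟩
        coordsᶻ p j ℚ.- coordsᶻ p₀ j
          ≡⟨ sym (coordsᶻ-- p p₀ j) ⟩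
        coordsᶻ (p -ᶻ p₀) j ∎)
        (sumClass-congruent p q p₀ q₀ (sym (proj₂ rep-spec)) j)
        where
        open ≡-Reasoning
        j∉J′ : j ∉ J′
        j∉J′ j∈J′ = j∉K (x∈p∩q⁺ (j∈J , j∈J′))

      G∈ : G (p , q) ∈L targets
      G∈ = ∈-cartesianProduct⁺ (sumClass∈ p∈ q∈) (Pκ.reduce∈ (p -ᶻ p₀) Σ≡0 pivot-difference-integral)
        where
        Σ≡0 : sum (coordsᶻ (p -ᶻ p₀)) ≡ 0ℚ
        Σ≡0 = trans (sum-cong-≗ (coordsᶻ-- p p₀))
                    (trans (sum-- (coordsᶻ p) (coordsᶻ p₀))
                           (cong₂ ℚ._-_ (Pσ.Σcoords≡0 p∈) (Pσ.Σcoords≡0 p₀∈)))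

    G-injective : ∀ {x x′} → x ∈L pairs → x′ ∈L pairs → G x ≡ G x′ → x ≡ x′
    G-injective {p , q} {p′ , q′} x∈ x′∈ Gx≡Gx′ = cong₂ _,_ p≡p′ q≡q′
      where
      open +-*-Solver
      p∈ = proj₁ (∈-cartesianProduct⁻ Pσ.points Pσ′.points x∈)
      q∈ = proj₂ (∈-cartesianProduct⁻ Pσ.points Pσ′.points x∈)
      p′∈ = proj₁ (∈-cartesianProduct⁻ Pσ.points Pσ′.points x′∈)
      q′∈ = proj₂ (∈-cartesianProduct⁻ Pσ.points Pσ′.points x′∈)
      p₀ = pivot (p , q)
      sum≡ : sumClass (p , q) ≡ sumClass (p′ , q′)
      sum≡ = cong proj₁ Gx≡Gx′
      reduced≡ : reduce Pκ.base (p -ᶻ p₀) ≡ reduce Pκ.base (p′ -ᶻ p₀)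
      reduced≡ = trans (cong proj₂ Gx≡Gx′)
        (cong (λ r → reduce Pκ.base (p′ -ᶻ proj₁ r)) (sym (representative-cong _≟ᶻ_ sumClass pairs x∈ sum≡)))
      p≡p′ : p ≡ p′
      p≡p′ = Pσ.congruent⇒≡ p∈ p′∈ (λ j → subst Integral
        (trans (cong₂ ℚ._-_ (coordsᶻ-- p p₀ j) (coordsᶻ-- p′ p₀ j))
               (solve 3 (λ P P′ P₀ → (P :- P₀) :- (P′ :- P₀) := P :- P′)
                        refl (coordsᶻ p j) (coordsᶻ p′ j) (coordsᶻ p₀ j)))
        (reduce-cong Pκ.base (p -ᶻ p₀) (p′ -ᶻ p₀) reduced≡ j))
      q≡q′ : q ≡ q′
      q≡q′ = Pσ′.congruent⇒≡ q∈ q′∈ (λ j → subst Integral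
        (trans (cong (λ r → (coordsᶻ p j ℚ.+ coordsᶻ q j) ℚ.- (coordsᶻ r j ℚ.+ coordsᶻ q′ j)) (sym p≡p′))
               (solve 3 (λ P Q Q′ → (P :+ Q) :- (P :+ Q′) := Q :- Q′) refl (coordsᶻ p j) (coordsᶻ q j) (coordsᶻ q′ j)))
        (sumClass-congruent p q p′ q′ sum≡ j))

    private
      lattice-σ  = σ.latticePoint (σ.contributes⇒s∣ν contrib)
      lattice-σ′ = σ′.latticePoint (σ′.contributes⇒s∣ν contrib′)
      y      = proj₁ lattice-σ
      y-supp = proj₁ (proj₂ lattice-σ)
      a·y≡ν  = proj₂ (proj₂ lattice-σ)
      y′      = proj₁ lattice-σ′
      y′-supp = proj₁ (proj₂ lattice-σ′)
      a·y′≡ν  = proj₂ (proj₂ lattice-σ′)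

    w : Vec ℤ n
    w = y -ᶻ y′

    -- If p + q ≡ y − y′ modulo the edges of τ, with integral coordinate defect ε, then
    -- u = y − p − Σ_{j ∈ J} ε j • v j is a lattice vector spanned by the v j with j ∈ J ∩ J′ and
    -- a · u ≡ ν(a) modulo N(τ), so s(κ) ∣ ν(a).
    module Obstruction {p q} (p∈ : p ∈L Pσ.points) (q∈ : q ∈L Pσ′.points)
                       (congruent : ∀ j → Integral ((coordsᶻ p j ℚ.+ coordsᶻ q j) ℚ.- coordsᶻ w j)) where
      open ≡-Reasoning
      open +-*-Solver
      ε : Fin n → ℚ
      ε j = coordsᶻ w j ℚ.- (coordsᶻ p j ℚ.+ coordsᶻ q j)

      e : Fin n → ℚ
      e = restrict J ε

      e-integral : ∀ j → Integral (e j)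
      e-integral = integral-restrict (λ j → subst Integral (solve 2 (λ A W → :- (A :- W) := W :- A) refl
                                                                     (coordsᶻ p j ℚ.+ coordsᶻ q j) (coordsᶻ w j))
                                                           (integral-neg (congruent j)))

      u : Fin n → ℚ
      u i = (ℤᵛ y i ℚ.- ℤᵛ p i) ℚ.- lincomb e vertex i

      cu : Fin n → ℚ
      cu j = (coordsᶻ y j ℚ.- coordsᶻ p j) ℚ.- e j

      u-coords : HasCoords u cu
      u-coords i = begin
        (ℤᵛ y i ℚ.- ℤᵛ p i) ℚ.- lincomb e vertex i
          ≡⟨ cong (ℚ._- lincomb e vertex i) (cong₂ ℚ._-_ (coords-spec (ℤᵛ y) i) (coords-spec (ℤᵛ p) i)) ⟩
        (lincomb (coordsᶻ y) vertex i ℚ.- lincomb (coordsᶻ p) vertex i) ℚ.- lincomb e vertex i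
          ≡⟨ cong (ℚ._- lincomb e vertex i) (sym (lincomb-- (coordsᶻ y) (coordsᶻ p) vertex i)) ⟩
        lincomb (λ j → coordsᶻ y j ℚ.- coordsᶻ p j) vertex i ℚ.- lincomb e vertex i
          ≡⟨ sym (lincomb-- (λ j → coordsᶻ y j ℚ.- coordsᶻ p j) e vertex i) ⟩
        lincomb cu vertex i ∎

      cu-outside-J : ∀ j → j ∉ J → cu j ≡ 0ℚ
      cu-outside-J j j∉J =
        trans (cong₂ (λ s t → (s ℚ.- t) ℚ.- e j) (σ.coords-outside (ℤᵛ y) y-supp j j∉J)
                                                (Pσ.coords-outside p∈ j j∉J))
              (cong (ℚ._-_ 0ℚ) (restrict-∉ ε j∉J))

      cu-J∖J′ : ∀ j → j ∈ J → j ∉ J′ → cu j ≡ 0ℚ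
      cu-J∖J′ j j∈J j∉J′ = begin
        (coordsᶻ y j ℚ.- coordsᶻ p j) ℚ.- e j
          ≡⟨ cong (ℚ._-_ (coordsᶻ y j ℚ.- coordsᶻ p j)) (restrict-∈ ε j∈J) ⟩
        (coordsᶻ y j ℚ.- coordsᶻ p j) ℚ.- (coordsᶻ w j ℚ.- (coordsᶻ p j ℚ.+ coordsᶻ q j))
          ≡⟨ cong₂ (λ s t → (coordsᶻ y j ℚ.- coordsᶻ p j) ℚ.- (s ℚ.- t)) (coordsᶻ-- y y′ j)
                   (trans (cong (coordsᶻ p j ℚ.+_) (Pσ′.coords-outside q∈ j j∉J′)) (ℚ.+-identityʳ (coordsᶻ p j))) ⟩
        (coordsᶻ y j ℚ.- coordsᶻ p j) ℚ.- ((coordsᶻ y j ℚ.- coordsᶻ y′ j) ℚ.- coordsᶻ p j)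
          ≡⟨ solve 3 (λ Y P Y′ → (Y :- P) :- ((Y :- Y′) :- P) := Y′)
                   refl (coordsᶻ y j) (coordsᶻ p j) (coordsᶻ y′ j) ⟩
        coordsᶻ y′ j
          ≡⟨ σ′.coords-outside (ℤᵛ y′) y′-supp j j∉J′ ⟩
        0ℚ ∎

      cu-supp : Supported (J ∩ J′) cu
      cu-supp j j∉K =
        [ (λ j∈J → cu-J∖J′ j j∈J (λ j∈J′ → j∉K (x∈p∩q⁺ (j∈J , j∈J′)))) , cu-outside-J j ]′ (toSum (j ∈? J))

      u-supp : Supported κ.I u
      u-supp i i∉I = trans (u-coords i) (lincomb-supported cu-supp κ.vertex-supported i i∉I)

      u-integral : ∀ i → Integral (u i)
      u-integral i = integral-- (integral-- (integral-ℤtoℚ (lookup y i)) (integral-ℤtoℚ (lookup p i)))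
                                (integral-sum (λ j → integral-* (e-integral j) (integral-ℤtoℚ (+ lookup (v j) i))))

      a·u≡ : ℕᵛ a · u ≡ ℕtoℚ (ν a) ℚ.- ℕtoℚ Nτ ℚ.* sum e
      a·u≡ = begin
        ℕᵛ a · u
          ≡⟨ ·-distrib-- (ℕᵛ a) (λ i → ℤᵛ y i ℚ.- ℤᵛ p i) (lincomb e vertex) ⟩
        ℕᵛ a · (λ i → ℤᵛ y i ℚ.- ℤᵛ p i) ℚ.- ℕᵛ a · lincomb e vertex
          ≡⟨ cong₂ ℚ._-_ (·-distrib-- (ℕᵛ a) (ℤᵛ y) (ℤᵛ p)) (a·x≡Nτ*Σc {c = e} (λ i → refl)) ⟩
        (ℕᵛ a · ℤᵛ y ℚ.- ℕᵛ a · ℤᵛ p) ℚ.- ℕtoℚ Nτ ℚ.* sum e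
          ≡⟨ cong (λ t → (t ℚ.- ℕᵛ a · ℤᵛ p) ℚ.- ℕtoℚ Nτ ℚ.* sum e) a·y≡ν ⟩
        (ℕtoℚ (ν a) ℚ.- ℕᵛ a · ℤᵛ p) ℚ.- ℕtoℚ Nτ ℚ.* sum e
          ≡⟨ cong (λ t → (ℕtoℚ (ν a) ℚ.- t) ℚ.- ℕtoℚ Nτ ℚ.* sum e)
                  (trans (a·x≡Nτ*Σc (coords-spec (ℤᵛ p)))
                         (trans (cong (ℕtoℚ Nτ ℚ.*_) (Pσ.Σcoords≡0 p∈)) (ℚ.*-zeroʳ (ℕtoℚ Nτ)))) ⟩
        (ℕtoℚ (ν a) ℚ.- 0ℚ) ℚ.- ℕtoℚ Nτ ℚ.* sum e
          ≡⟨ cong (ℚ._- ℕtoℚ Nτ ℚ.* sum e) (ℚ.+-identityʳ (ℕtoℚ (ν a))) ⟩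
        ℕtoℚ (ν a) ℚ.- ℕtoℚ Nτ ℚ.* sum e ∎

      ν≡ : ℕᵛ a · u ℚ.+ ℕtoℚ κ.s ℚ.* (ℕtoℚ N″ ℚ.* sum e) ≡ ℕtoℚ (ν a)
      ν≡ = begin
        ℕᵛ a · u ℚ.+ ℕtoℚ κ.s ℚ.* (ℕtoℚ N″ ℚ.* sum e)
          ≡⟨ cong₂ ℚ._+_ a·u≡ (trans (sym (ℚ.*-assoc (ℕtoℚ κ.s) (ℕtoℚ N″) (sum e)))
                                     (cong (ℚ._* sum e) (trans (sym (ℕtoℚ-* κ.s N″)) (cong ℕtoℚ (sym κ.Nτ≡s*N))))) ⟩
        (ℕtoℚ (ν a) ℚ.- ℕtoℚ Nτ ℚ.* sum e) ℚ.+ ℕtoℚ Nτ ℚ.* sum e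
          ≡⟨ solve 2 (λ V T → (V :- T) :+ T := V) refl (ℕtoℚ (ν a)) (ℕtoℚ Nτ ℚ.* sum e) ⟩
        ℕtoℚ (ν a) ∎

      κ-divides : κ.s ∣ ν a
      κ-divides = ∣ℚ⇒∣ (subst (κ.s ∣ℚ_) ν≡ (∣ℚ-+ {κ.s} (κ.s∣ℚa·u u u-integral u-supp)
                                         (∣ℚ-* {κ.s} (integral-* (integral-ℤtoℚ (+ N″)) (integral-sum e-integral)))))

    Σcoords-w≡0 : sum (coordsᶻ w) ≡ 0ℚ
    Σcoords-w≡0 = x*y≡0⇒y≡0 (Nτ≢0 ∘ ℕtoℚ-injective) (begin
      ℕtoℚ Nτ ℚ.* sum (coordsᶻ w)          ≡⟨ sym (a·x≡Nτ*Σc (coords-spec (ℤᵛ w))) ⟩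
      ℕᵛ a · ℤᵛ w                          ≡⟨ ·-congʳ (ℕᵛ a) (ℤᵛ-- y y′) ⟩
      ℕᵛ a · (λ i → ℤᵛ y i ℚ.- ℤᵛ y′ i)     ≡⟨ ·-distrib-- (ℕᵛ a) (ℤᵛ y) (ℤᵛ y′) ⟩
      ℕᵛ a · ℤᵛ y ℚ.- ℕᵛ a · ℤᵛ y′          ≡⟨ cong₂ ℚ._-_ a·y≡ν a·y′≡ν ⟩
      ℕtoℚ (ν a) ℚ.- ℕtoℚ (ν a)            ≡⟨ ℚ.+-inverseʳ (ℕtoℚ (ν a)) ⟩
      0ℚ                                   ∎)
      where open ≡-Reasoning

    missed : Pair
    missed = reduce Pτ.base w , Vec.replicate n (+ 0)

    missed∈ : missed ∈L targets
    missed∈ = ∈-cartesianProduct⁺ (Pτ.reduce∈ w Σcoords-w≡0 (λ j j∉⊤ → ⊥-elim (j∉⊤ ∈⊤))) Pκ.origin∈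

    G-misses : ∀ {x} → x ∈L pairs → G x ≢ missed
    G-misses {p , q} x∈ Gx≡missed =
      ¬contrib″ (κ.s∣ν⇒contributes (parallelepiped-1≤m {v = v} (parallelepiped nv″))
                                   (Obstruction.κ-divides p∈ q∈ congruent))
      where
      p∈ = proj₁ (∈-cartesianProduct⁻ Pσ.points Pσ′.points x∈)
      q∈ = proj₂ (∈-cartesianProduct⁻ Pσ.points Pσ′.points x∈)
      congruent : ∀ j → Integral ((coordsᶻ p j ℚ.+ coordsᶻ q j) ℚ.- coordsᶻ w j)
      congruent j = subst Integral (cong (ℚ._- coordsᶻ w j) (coordsᶻ-+ p q j))
                                   (reduce-cong Pτ.base (p +ᶻ q) w (cong proj₁ Gx≡missed) j)

    m*m′<mτ*m″ : m * m′ < mτ * m″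
    m*m′<mτ*m″ = subst₂ _<_
      (trans (length-cartesianProduct Pσ.points Pσ′.points) (cong₂ _*_ Pσ.length≡ Pσ′.length≡))
      (trans (length-cartesianProduct Pτ.points Pκ.points) (cong₂ _*_ Pτ.length≡ Pκ.length≡))
      (injection-length-< (Product.≡-dec _≟ᶻ_ _≟ᶻ_) G pairs targets (Unique.cartesianProduct⁺ Pσ.unique Pσ′.unique)
                          G-injective G∈-pairs missed∈ G-misses)
      where
      G∈-pairs : ∀ {x} → x ∈L pairs → G x ∈L targets
      G∈-pairs {p , q} x∈ = G∈ (proj₁ (∈-cartesianProduct⁻ Pσ.points Pσ′.points x∈))
                               (proj₂ (∈-cartesianProduct⁻ Pσ.points Pσ′.points x∈))

-- With a > 0, N(τ) = 0 forces every vertex to be the origin, hence N = 0.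
degenerate-contributes : ∀ {n} {v : Fin n → Point n} {a : Fin n → ℕ} {K : Subset n} {N m} →
                         (∀ i → 1 ≤ a i) → (∀ j → dot a (v j) ≡ 0) → Nonempty K → IsN v K N → IsNV v K m →
                         Contributes 0 (ν a) N m
degenerate-contributes {v = v} {a} {N = N} a-positive a·v≡0 (j , j∈K) isN nv =
  parallelepiped-1≤m {v = v} (parallelepiped nv) , divides 0 (trans (cong (ν a *_) N≡0) (ℕ.*-zeroʳ (ν a)))
  where
  open VFaceData (vFaceData {v = v} isN)
  N≡0 : N ≡ 0
  N≡0 = trans (sym (b·v≡N j j∈K)) (dot-origin b {v j} (positive-dot≡0 {x = v j} a-positive (a·v≡0 j)))

-- Only the facet conditions a > 0, a · v j ≡ N(τ) and affine independence of the v j are used.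
mainTheorem5 : ∀ {n} (S : List (Point n)) (a : Fin n → ℕ) (v : Fin n → Point n) (Nτ : ℕ) →
    IsSimplicialFacet S a v Nτ →
    (J J' : Subset n) → Nonempty J → Nonempty J' → Nonempty (J ∩ J') →
    (N N' N'' mτ m m' m'' M : ℕ) →
    IsNV v ⊤ mτ →
    IsN v J N → IsNV v J m →
    IsN v J' N' → IsNV v J' m' →
    IsN v (J ∩ J') N'' → IsNV v (J ∩ J') m'' →
    mτ * m'' ≡ m * m' * M →
    Contributes Nτ (ν a) N m → Contributes Nτ (ν a) N' m' →
    ¬ Contributes Nτ (ν a) N'' m'' →
    2 ≤ M
mainTheorem5 S a v Nτ (a-positive , _ , _ , _ , a·v≡Nτ , aff , _) J J′ J≢∅ J′≢∅ K≢∅ N N′ N″ mτ m m′ m″ M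
             nvτ isN nv isN′ nv′ isN″ nv″ mτ*m″≡m*m′*M contrib contrib′ ¬contrib″ =
  [ degenerate , nondegenerate ]′ (toSum (Nτ ℕ.≟ 0))
  where
  degenerate : Nτ ≡ 0 → 2 ≤ M
  degenerate Nτ≡0 = ⊥-elim (¬contrib″ (subst (λ t → Contributes t (ν a) N″ m″) (sym Nτ≡0)
    (degenerate-contributes {v = v} a-positive (λ j → trans (a·v≡Nτ j) Nτ≡0) K≢∅ isN″ nv″)))
  nondegenerate : Nτ ≢ 0 → 2 ≤ M
  nondegenerate Nτ≢0 = ℕ.*-cancelˡ-< (m * m′) 1 M
    (subst₂ _<_ (sym (ℕ.*-identityʳ (m * m′))) mτ*m″≡m*m′*M m*m′<mτ*m″)
    where
    open Simplex.Counting v a Nτ Nτ≢0 a·v≡Nτ aff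
           J≢∅ J′≢∅ K≢∅ nvτ isN nv isN′ nv′ isN″ nv″ contrib contrib′ ¬contrib″
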